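{- (a) If $T$ is a finite tree with at least $2$ vertices, then $0\le\iota(T)\le \ell(T)/2-1$. (b) Given integers $a$ and $b$ with $0\le a\le b/2-1$, there is a tree $T$ with $\iota(T)=a$ and $\ell(T)=b$. (c) If $T$ is a finite tree, then $\iota(T)$ is positive if and only if $T$ has two adjacent vertices each of degree at least $3$.
   Context: $\ell(T)$ denotes the number of leaves of $T$. A starlike tree is a tree with exactly one vertex of degree at least $3$ (its central vertex). If a tree $T$ has at least two vertices of degree at least $3$, a starlike splitting of $T$ is a $4$-tuple $(S,T',v_s,v_t)$ where $S$ is a starlike tree, $T'$ is a tree, $v_s$ is a leaf of $S$ adjacent to the central vertex of $S$, $v_t\in V(T')$, and $T$ is obtained from $S$ and $T'$ by identifying $v_s$ with $v_t$; it is regular if $v_t$ has degree $1$ in $T'$ and irregular otherwise. Repeatedly applying starlike splittings (to the remaining tree $T'$) until the remaining tree is a starlike tree or a path graph yields a starlike decomposition of $T$. The splitting irregularity number $\iota(T)$ is the number of irregular splittings in such a sequence; it does not depend on the sequence chosen (and $\iota(T)=0$ when $T$ is a starlike tree or path graph). -}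

module Defs where

open import Data.Nat using (ℕ; zero; suc; _+_; _*_; _≤_; _<_; _≡ᵇ_)
open import Data.Bool using (Bool; true; false; if_then_else_; _∨_)
open import Data.Fin using (Fin; toℕ)
open import Data.List using (List; []; _∷_; _++_; [_]; length; map; allFin)
open import Data.Nat.ListAction using (sum)
open import Data.List.Relation.Unary.Linked using (Linked)
open import Data.List.Relation.Unary.Unique.Propositional using (Unique)
open import Data.Product using (Σ; ∃; _×_; _,_)
open import Data.Sum using (_⊎_)
open import Relation.Binary.PropositionalEquality using (_≡_; _≢_)
open import Relation.Nullary using (¬_)
open import Function.Bundles using (_↔_; Inverse)
open import Function.Definitions using (Injective)

-- A finite (simple) graph: vertex set Fin size, Boolean adjacency.
-- Simplicity (symmetry, irreflexivity) is imposed in IsTree.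
record Graph : Set where
  constructor graph
  field
    size : ℕ
    adj  : Fin size → Fin size → Bool
open Graph public

Adj : (G : Graph) → Fin (size G) → Fin (size G) → Set
Adj G u v = adj G u v ≡ true

degree : (G : Graph) → Fin (size G) → ℕ
degree G v = sum (map (λ w → if adj G v w then 1 else 0) (allFin (size G)))

leaves : Graph → ℕ
leaves G = sum (map (λ v → if degree G v ≡ᵇ 1 then 1 else 0) (allFin (size G)))

data Walk (G : Graph) : Fin (size G) → Fin (size G) → Set where
  here : ∀ {u} → Walk G u u
  step : ∀ {u w v} → Adj G u w → Walk G w v → Walk G u v

Symmetric : Graph → Set
Symmetric G = ∀ u v → adj G u v ≡ adj G v u

Irreflexive : Graph → Set
Irreflexive G = ∀ u → adj G u u ≡ false

Connected : Graph → Set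
Connected G = ∀ u v → Walk G u v

Acyclic : Graph → Set
Acyclic G = ∀ (x : Fin (size G)) (xs : List (Fin (size G))) →
  2 ≤ length xs → Unique (x ∷ xs) → ¬ Linked (Adj G) (x ∷ xs ++ [ x ])

IsTree : Graph → Set
IsTree G = 1 ≤ size G × Symmetric G × Irreflexive G × Connected G × Acyclic G

Iso : Graph → Graph → Set
Iso G H = Σ (Fin (size G) ↔ Fin (size H)) λ f →
  ∀ i j → adj H (Inverse.to f i) (Inverse.to f j) ≡ adj G i j

pathGraph : ℕ → Graph
pathGraph n = graph n (λ i j → (toℕ i ≡ᵇ suc (toℕ j)) ∨ (toℕ j ≡ᵇ suc (toℕ i)))

IsPath : Graph → Set
IsPath G = Σ ℕ λ n → Iso G (pathGraph n)

IsCentre : (S : Graph) → Fin (size S) → Set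
IsCentre S c = 3 ≤ degree S c × (∀ v → 3 ≤ degree S v → v ≡ c)

Starlike : Graph → Set
Starlike S = IsTree S × ∃ λ c → IsCentre S c

TwoBranch : Graph → Set
TwoBranch T = Σ (Fin (size T)) λ u → Σ (Fin (size T)) λ v →
  u ≢ v × 3 ≤ degree T u × 3 ≤ degree T v

-- T is obtained from S and T' by identifying vs with vt:
-- σ, τ embed S and T' into T, their images cover T and meet exactly in σ vs = τ vt,
-- adjacency inside each image is that of S resp. T', and there are no other edges.
Glue : (T S T' : Graph) → Fin (size S) → Fin (size T') → Set
Glue T S T' vs vt =
  Σ (Fin (size S) → Fin (size T)) λ σ → Σ (Fin (size T') → Fin (size T)) λ τ →
    Injective _≡_ _≡_ σ × Injective _≡_ _≡_ τ ×
    σ vs ≡ τ vt ×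
    (∀ a b → σ a ≡ τ b → a ≡ vs × b ≡ vt) ×
    (∀ x → (∃ λ a → σ a ≡ x) ⊎ (∃ λ b → τ b ≡ x)) ×
    (∀ a b → adj T (σ a) (σ b) ≡ adj S a b) ×
    (∀ a b → adj T (τ a) (τ b) ≡ adj T' a b) ×
    (∀ a b → a ≢ vs → b ≢ vt → adj T (σ a) (τ b) ≡ false × adj T (τ b) (σ a) ≡ false)

Splitting : (T S T' : Graph) → Fin (size S) → Fin (size T') → Set
Splitting T S T' vs vt =
  TwoBranch T × Starlike S × IsTree T' ×
  (Σ (Fin (size S)) λ c → IsCentre S c × degree S vs ≡ 1 × Adj S c vs) ×
  Glue T S T' vs vt

-- contribution of a splitting: 0 if regular (deg_{T'} vt = 1), 1 if irregular
irregularity : (T' : Graph) → Fin (size T') → ℕ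
irregularity T' vt = if degree T' vt ≡ᵇ 1 then 0 else 1

data Decomposition : Graph → ℕ → Set where
  stop  : ∀ {T} → Starlike T ⊎ (IsTree T × IsPath T) → Decomposition T 0
  split : ∀ {T S T' vs vt k} → Splitting T S T' vs vt → Decomposition T' k →
          Decomposition T (irregularity T' vt + k)

Iota : Graph → ℕ → Set
Iota T k = Decomposition T k

AdjacentBranches : Graph → Set
AdjacentBranches T = Σ (Fin (size T)) λ u → Σ (Fin (size T)) λ v →
  Adj T u v × 3 ≤ degree T u × 3 ≤ degree T v

-- (a) A splitting glues a starlike tree S, which has at least three leaves, to T′ at a leaf vs of S;
-- the glued vertex has degree at least 2 in T, so ℓ(T) = ℓ(S) + ℓ(T′) − 1 − [the splitting is regular].
-- Each splitting thus adds at least one leaf and each irregular one at least two, while the last tree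
-- (starlike, or a path on at least two vertices) has at least two leaves; ℓ is counted by a sum over the
-- vertices that splits along the gluing.
-- (c) In an irregular splitting the centre of S and the glued vertex are adjacent branch vertices; in a
-- regular one the glued vertex has degree 2, so adjacent branch vertices of T are already in T′.
-- (b) Starting from a star with m ≥ 2 leaves and repeatedly attaching a new vertex with two pendant leaves
-- to the last new vertex gives a caterpillar with a + 1 spine vertices and 2a + m leaves, which splits
-- back with a irregular splittings. Any decomposition has that many: if every branch vertex carries two
-- pendant leaves and no vertex of degree 2 touches a branch vertex, then every splitting is irregular,
-- both properties pass to T′, and ι equals the number of branch vertices minus one.

module Submission where

open import Defs
open import Data.Bool using (Bool; true; false; if_then_else_; _∨_)
open import Data.Bool.Properties using (T-≡)
import Data.Bool as Bool
open import Data.Empty using (⊥; ⊥-elim)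
open import Data.Fin using (Fin; toℕ) renaming (zero to fzero; suc to fsuc)
import Data.Fin.Properties as Fin
open import Data.List using (List; []; _∷_; _++_; [_]; length; map; allFin; filter)
open import Data.List.Properties
  using (++-assoc; ++-identityʳ; length-++; length-map; map-++; map-∘; map-cong; map-cong-local; map-tabulate)
open import Data.List.Membership.Propositional using (_∈_; _∉_)
open import Data.List.Membership.Propositional.Properties
  using (∈-allFin; ∈-∃++; ∈-++⁺ˡ; ∈-++⁺ʳ; ∈-++⁻; ∈-map⁺; ∈-map⁻; ∈-filter⁺; ∈-filter⁻)
open import Data.List.Membership.Propositional.Properties.WithK using (unique∧set⇒bag)
open import Data.List.Relation.Binary.BagAndSetEquality using (∼bag⇒↭)
open import Data.List.Relation.Binary.Permutation.Propositional.Properties using () renaming (map⁺ to ↭-map⁺)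
open import Data.List.Relation.Unary.Any using (here; there)
open import Data.List.Relation.Unary.All as All using (All; []; _∷_)
open import Data.List.Relation.Unary.All.Properties using (¬Any⇒All¬; ++⁻ˡ)
open import Data.List.Relation.Unary.AllPairs using (AllPairs; []; _∷_)
open import Data.List.Relation.Unary.Linked using (Linked; []; [-]; _∷_)
import Data.List.Relation.Unary.Linked.Properties as Linked
open import Data.List.Relation.Unary.Unique.Propositional using (Unique)
import Data.List.Relation.Unary.Unique.Propositional.Properties as Unique
open import Data.Nat using (ℕ; zero; suc; _+_; _*_; _∸_; _≤_; _<_; _≡ᵇ_; _≤ᵇ_; _≤?_; z≤n; s≤s; s≤s⁻¹)
open import Data.Nat.ListAction using (sum)
open import Data.Nat.ListAction.Properties using (sum-↭; sum-++)
open import Data.Nat.Properties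
open import Data.Nat.Solver using (module +-*-Solver)
open import Data.Product using (Σ; ∃; ∃₂; _×_; _,_; proj₁; proj₂)
open import Data.Sum using (_⊎_; inj₁; inj₂)
open import Function using (_∘_; mk⇔)
open import Function.Bundles using (Inverse; Equivalence; mk↔ₛ′)
open import Function.Definitions using (Injective)
open import Relation.Binary.PropositionalEquality hiding ([_])
open import Relation.Nullary using (¬_; Dec; does; yes; no; ¬?; _×-dec_)
open import Relation.Nullary.Decidable using (decidable-stable; dec-true; dec-false)
open +-*-Solver using (solve; _:+_; _:*_; _:=_; con)

indicator : Bool → ℕ
indicator b = if b then 1 else 0

sumFin : (n : ℕ) → (Fin n → ℕ) → ℕ
sumFin n f = sum (map f (allFin n))

-- degree G v and leaves G from Defs unfold to countFin (size G) (adj G v) and countFin (size G) ((_≡ᵇ 1) ∘ degree G).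
countFin : (n : ℕ) → (Fin n → Bool) → ℕ
countFin n p = sumFin n (indicator ∘ p)

sumFin-suc : ∀ n (f : Fin (suc n) → ℕ) → sumFin (suc n) f ≡ f fzero + sumFin n (f ∘ fsuc)
sumFin-suc n f = cong (λ xs → f fzero + sum xs)
  (trans (map-tabulate fsuc f) (sym (map-tabulate (λ i → i) (f ∘ fsuc))))

sumFin-cong : ∀ n {f g : Fin n → ℕ} → (∀ i → f i ≡ g i) → sumFin n f ≡ sumFin n g
sumFin-cong n f≗g = cong sum (map-cong f≗g (allFin n))

sumFin-zero : ∀ n {f : Fin n → ℕ} → (∀ i → f i ≡ 0) → sumFin n f ≡ 0
sumFin-zero zero    f≡0 = refl
sumFin-zero (suc n) {f} f≡0 = begin
  sumFin (suc n) f             ≡⟨ sumFin-suc n f ⟩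
  f fzero + sumFin n (f ∘ fsuc) ≡⟨ cong₂ _+_ (f≡0 fzero) (sumFin-zero n (f≡0 ∘ fsuc)) ⟩
  0                            ∎
  where open ≡-Reasoning

sumFin-update : ∀ n (f g : Fin n → ℕ) v → (∀ i → i ≢ v → f i ≡ g i) →
                sumFin n f + g v ≡ sumFin n g + f v
sumFin-update (suc n) f g fzero f≡g = begin
  sumFin (suc n) f + g fzero                    ≡⟨ cong (_+ g fzero) (sumFin-suc n f) ⟩
  f fzero + sumFin n (f ∘ fsuc) + g fzero       ≡⟨ cong (λ s → f fzero + s + g fzero) tails ⟩
  f fzero + sumFin n (g ∘ fsuc) + g fzero       ≡⟨ swap (f fzero) _ (g fzero) ⟩
  g fzero + sumFin n (g ∘ fsuc) + f fzero       ≡⟨ cong (_+ f fzero) (sym (sumFin-suc n g)) ⟩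
  sumFin (suc n) g + f fzero                    ∎
  where
  open ≡-Reasoning
  tails : sumFin n (f ∘ fsuc) ≡ sumFin n (g ∘ fsuc)
  tails = sumFin-cong n (λ i → f≡g (fsuc i) (λ ()))
  swap : ∀ a s b → a + s + b ≡ b + s + a
  swap = solve 3 (λ a s b → a :+ s :+ b := b :+ s :+ a) refl
sumFin-update (suc n) f g (fsuc v) f≡g = begin
  sumFin (suc n) f + g (fsuc v)                   ≡⟨ cong (_+ g (fsuc v)) (sumFin-suc n f) ⟩
  f fzero + sumFin n (f ∘ fsuc) + g (fsuc v)      ≡⟨ +-assoc (f fzero) _ _ ⟩
  f fzero + (sumFin n (f ∘ fsuc) + g (fsuc v))    ≡⟨ cong₂ _+_ (f≡g fzero (λ ())) tails ⟩
  g fzero + (sumFin n (g ∘ fsuc) + f (fsuc v))    ≡⟨ sym (+-assoc (g fzero) _ _) ⟩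
  g fzero + sumFin n (g ∘ fsuc) + f (fsuc v)      ≡⟨ cong (_+ f (fsuc v)) (sym (sumFin-suc n g)) ⟩
  sumFin (suc n) g + f (fsuc v)                   ∎
  where
  open ≡-Reasoning
  tails : sumFin n (f ∘ fsuc) + g (fsuc v) ≡ sumFin n (g ∘ fsuc) + f (fsuc v)
  tails = sumFin-update n (f ∘ fsuc) (g ∘ fsuc) v (λ i i≢v → f≡g (fsuc i) (i≢v ∘ Fin.suc-injective))

sumFin-point : ∀ n (f : Fin n → ℕ) v → (∀ i → i ≢ v → f i ≡ 0) → sumFin n f ≡ f v
sumFin-point n f v f≡0 = begin
  sumFin n f                  ≡⟨ sym (+-identityʳ _) ⟩
  sumFin n f + 0              ≡⟨ sumFin-update n f (λ _ → 0) v f≡0 ⟩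
  sumFin n (λ _ → 0) + f v    ≡⟨ cong (_+ f v) (sumFin-zero n (λ _ → refl)) ⟩
  f v                         ∎
  where open ≡-Reasoning

sumFin-enumeration : ∀ {n} (f : Fin n → ℕ) (L : List (Fin n)) → Unique L → (∀ i → i ∈ L) →
                     sumFin n f ≡ sum (map f L)
sumFin-enumeration {n} f L uniq complete = sum-↭ (↭-map⁺ f (∼bag⇒↭
  (unique∧set⇒bag (Unique.allFin⁺ n) uniq (mk⇔ (λ _ → complete _) (λ _ → ∈-allFin _)))))

removing : ∀ {n} → (Fin n → Bool) → Fin n → Fin n → Bool
removing p x i = if does (i Fin.≟ x) then false else p i

countFin-removing : ∀ n (p : Fin n → Bool) x → p x ≡ true → countFin n p ≡ suc (countFin n (removing p x))
countFin-removing n p x px = begin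
  countFin n p                                  ≡⟨ sym (+-identityʳ _) ⟩
  countFin n p + 0                              ≡⟨ cong (λ b → countFin n p + indicator b) (sym removed) ⟩
  countFin n p + indicator (removing p x x)      ≡⟨ sumFin-update n (indicator ∘ p) (indicator ∘ removing p x) x agree ⟩
  countFin n (removing p x) + indicator (p x)   ≡⟨ cong (λ b → countFin n (removing p x) + indicator b) px ⟩
  countFin n (removing p x) + 1                 ≡⟨ +-comm _ 1 ⟩
  suc (countFin n (removing p x))               ∎
  where
  open ≡-Reasoning
  removed : removing p x x ≡ false
  removed with x Fin.≟ x
  ... | yes _ = refl
  ... | no x≢x = ⊥-elim (x≢x refl)
  agree : ∀ i → i ≢ x → indicator (p i) ≡ indicator (removing p x i)
  agree i i≢x with i Fin.≟ x
  ... | yes i≡x = ⊥-elim (i≢x i≡x)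
  ... | no _ = refl

removing-≢ : ∀ {n} (p : Fin n → Bool) {x i} → i ≢ x → removing p x i ≡ p i
removing-≢ p {x} {i} i≢x with i Fin.≟ x
... | yes i≡x = ⊥-elim (i≢x i≡x)
... | no _ = refl

removing-true : ∀ {n} (p : Fin n → Bool) {x i} → removing p x i ≡ true → i ≢ x × p i ≡ true
removing-true p {x} {i} r with i Fin.≟ x
removing-true p {x} {i} () | yes _
... | no i≢x = i≢x , r

countFin-≥-distinct : ∀ n (p : Fin n → Bool) (L : List (Fin n)) → Unique L → All (λ i → p i ≡ true) L →
                      length L ≤ countFin n p
countFin-≥-distinct n p [] _ _ = z≤n
countFin-≥-distinct n p (x ∷ L) (x∉L ∷ uL) (px ∷ pL) =
  subst (suc (length L) ≤_) (sym (countFin-removing n p x px))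
    (s≤s (countFin-≥-distinct n (removing p x) L uL
      (All.zipWith (λ (x≢i , pi) → trans (removing-≢ p (x≢i ∘ sym)) pi) (x∉L , pL))))

countFin-witness : ∀ n (p : Fin n → Bool) → 1 ≤ countFin n p → ∃ λ x → p x ≡ true
countFin-witness (suc n) p pos with p fzero in p0 | subst (1 ≤_) (sumFin-suc n (indicator ∘ p)) pos
... | true  | _    = fzero , p0
... | false | pos′ = let x , px = countFin-witness n (p ∘ fsuc) pos′ in fsuc x , px

countFin-witnesses : ∀ n (p : Fin n → Bool) k → k ≤ countFin n p →
                     Σ (List (Fin n)) λ L → length L ≡ k × Unique L × All (λ i → p i ≡ true) L
countFin-witnesses n p zero _ = [] , refl , [] , []
countFin-witnesses n p (suc k) k<count with countFin-witness n p (≤-trans (s≤s z≤n) k<count)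
... | x , px with countFin-witnesses n (removing p x) k
                    (s≤s⁻¹ (subst (suc k ≤_) (countFin-removing n p x px) k<count))
... | L , refl , uL , rL = x ∷ L , refl ,
  All.map (λ r i≡x → proj₁ (removing-true p r) (sym i≡x)) rL ∷ uL ,
  px ∷ All.map (λ r → proj₂ (removing-true p r)) rL

countFin-true : ∀ n → countFin n (λ _ → true) ≡ n
countFin-true zero = refl
countFin-true (suc n) = trans (sumFin-suc n (λ _ → 1)) (cong suc (countFin-true n))

unique-length-≤ : ∀ {n} {L : List (Fin n)} → Unique L → length L ≤ n
unique-length-≤ {n} {L} uniq = subst (length L ≤_) (countFin-true n)
  (countFin-≥-distinct n (λ _ → true) L uniq (All.universal (λ _ → refl) L))

countFin-≤-1 : ∀ n (p : Fin n → Bool) → (∀ {x y} → p x ≡ true → p y ≡ true → x ≡ y) → countFin n p ≤ 1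
countFin-≤-1 n p unique with 2 ≤? countFin n p
... | no count≱2 = ≤-pred (≰⇒> count≱2)
... | yes count≥2 with countFin-witnesses n p 2 count≥2
... | x ∷ y ∷ [] , _ , (x≢y ∷ []) ∷ [] ∷ [] , px ∷ py ∷ [] = ⊥-elim (x≢y (unique px py))

countFin-∨ : ∀ n (p q : Fin n → Bool) → countFin n (λ i → p i ∨ q i) ≤ countFin n p + countFin n q
countFin-∨ zero p q = z≤n
countFin-∨ (suc n) p q = begin
  countFin (suc n) (λ i → p i ∨ q i)
    ≡⟨ sumFin-suc n _ ⟩
  indicator (p fzero ∨ q fzero) + countFin n (λ i → p (fsuc i) ∨ q (fsuc i))
    ≤⟨ +-mono-≤ (indicator-∨ (p fzero) (q fzero)) (countFin-∨ n (p ∘ fsuc) (q ∘ fsuc)) ⟩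
  indicator (p fzero) + indicator (q fzero) + (countFin n (p ∘ fsuc) + countFin n (q ∘ fsuc))
    ≡⟨ solve 4 (λ a b c d → a :+ b :+ (c :+ d) := a :+ c :+ (b :+ d)) refl
         (indicator (p fzero)) (indicator (q fzero)) (countFin n (p ∘ fsuc)) (countFin n (q ∘ fsuc)) ⟩
  indicator (p fzero) + countFin n (p ∘ fsuc) + (indicator (q fzero) + countFin n (q ∘ fsuc))
    ≡⟨ sym (cong₂ _+_ (sumFin-suc n (indicator ∘ p)) (sumFin-suc n (indicator ∘ q))) ⟩
  countFin (suc n) p + countFin (suc n) q ∎
  where
  open ≤-Reasoning
  indicator-∨ : ∀ a b → indicator (a ∨ b) ≤ indicator a + indicator b
  indicator-∨ true  _     = s≤s z≤n
  indicator-∨ false true  = s≤s z≤n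
  indicator-∨ false false = z≤n

≡ᵇ-true : ∀ {m n} → (m ≡ᵇ n) ≡ true → m ≡ n
≡ᵇ-true {m} {n} m≡ᵇn = ≡ᵇ⇒≡ m n (Equivalence.from T-≡ m≡ᵇn)

not-leaf : ∀ {d} → 2 ≤ d → (d ≡ᵇ 1) ≡ false
not-leaf (s≤s (s≤s _)) = refl

module _ {A : Set} {R : A → A → Set} where

  linked-prefix : ∀ xs {ys} → Linked R (xs ++ ys) → Linked R xs
  linked-prefix []           _          = []
  linked-prefix (x ∷ [])     _          = [-]
  linked-prefix (x ∷ y ∷ xs) (r ∷ rs)   = r ∷ linked-prefix (y ∷ xs) rs

  linked-suffix : ∀ xs {ys} → Linked R (xs ++ ys) → Linked R ys
  linked-suffix []           rs         = rs
  linked-suffix (x ∷ [])     [-]        = []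
  linked-suffix (x ∷ [])     (_ ∷ rs)   = rs
  linked-suffix (x ∷ y ∷ xs) (_ ∷ rs)   = linked-suffix (y ∷ xs) rs

  linked-snoc : ∀ xs {x y} → Linked R (xs ++ [ x ]) → R x y → Linked R ((xs ++ [ x ]) ++ [ y ])
  linked-snoc []           _        r = r ∷ [-]
  linked-snoc (_ ∷ [])     (r′ ∷ _) r = r′ ∷ r ∷ [-]
  linked-snoc (_ ∷ z ∷ xs) (r′ ∷ l) r = r′ ∷ linked-snoc (z ∷ xs) l r

  linked-last : ∀ xs {p x} → Linked R ((xs ++ [ p ]) ++ [ x ]) → R p x
  linked-last []           (r ∷ _) = r
  linked-last (_ ∷ [])     (_ ∷ l) = linked-last [] l
  linked-last (_ ∷ z ∷ xs) (_ ∷ l) = linked-last (z ∷ xs) l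

  allPairs-prefix : ∀ xs {ys} → AllPairs R (xs ++ ys) → AllPairs R xs
  allPairs-prefix []       _          = []
  allPairs-prefix (x ∷ xs) (px ∷ ps) = ++⁻ˡ xs px ∷ allPairs-prefix xs ps

  allPairs-suffix : ∀ xs {ys} → AllPairs R (xs ++ ys) → AllPairs R ys
  allPairs-suffix []       ps        = ps
  allPairs-suffix (x ∷ xs) (_ ∷ ps) = allPairs-suffix xs ps

end : {A : Set} → A → List A → A
end x []       = x
end x (y ∷ ys) = end y ys

end-∈ : {A : Set} (x : A) (xs : List A) → end x xs ∈ x ∷ xs
end-∈ x []       = here refl
end-∈ x (y ∷ ys) = there (end-∈ y ys)

unique-++-apart : ∀ {A : Set} xs {ys : List A} {a b} → Unique (xs ++ ys) → a ∈ xs → b ∈ ys → a ≢ b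
unique-++-apart (x ∷ xs) (x∉ ∷ _) (here refl) b∈ys = All.lookup x∉ (∈-++⁺ʳ xs b∈ys)
unique-++-apart (x ∷ xs) (_ ∷ uniq) (there a∈xs) b∈ys = unique-++-apart xs uniq a∈xs b∈ys

module _ {A : Set} {R : A → A → Set} where

  linked-end : ∀ x xs {z zs} → Linked R (x ∷ xs ++ z ∷ zs) → R (end x xs) z
  linked-end x []       (r ∷ _) = r
  linked-end x (y ∷ ys) (_ ∷ l) = linked-end y ys l

  cycle-neighbours : ∀ x xs → 2 ≤ length xs → Unique (x ∷ xs) → Linked R (x ∷ xs ++ [ x ]) →
                     ∀ {y} → y ∈ x ∷ xs → ∃₂ λ p q → p ≢ q × R p y × R y q
  cycle-neighbours x (_ ∷ []) (s≤s ()) _ _ (here refl)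
  cycle-neighbours x (x₁ ∷ x₂ ∷ xs) _ (_ ∷ (x₁∉ ∷ _)) (x~x₁ ∷ linked) (here refl) =
    end x₂ xs , x₁ , (λ e → All.lookup x₁∉ (subst (_∈ x₂ ∷ xs) e (end-∈ x₂ xs)) refl) ,
    linked-end x₁ (x₂ ∷ xs) linked , x~x₁
  cycle-neighbours x xs long uniq linked (there y∈xs) with ∈-∃++ y∈xs
  ... | P , Q , refl = end x P , successor Q , distinct P Q long uniq ,
        linked-end x P closed ,
        to-successor Q (linked-suffix (x ∷ P) closed)
    where
    closed : Linked R ((x ∷ P) ++ _ ∷ Q ++ [ x ])
    closed = subst (Linked R) (cong (x ∷_) (++-assoc P (_ ∷ Q) [ x ])) linked
    successor : List A → A
    successor []      = x
    successor (q ∷ _) = q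
    to-successor : ∀ {y} Q → Linked R (y ∷ Q ++ [ x ]) → R y (successor Q)
    to-successor []      (r ∷ _) = r
    to-successor (_ ∷ _) (r ∷ _) = r
    distinct : ∀ {y} P Q → 2 ≤ length (P ++ y ∷ Q) → Unique (x ∷ P ++ y ∷ Q) → end x P ≢ successor Q
    distinct (p ∷ P) [] _ (x∉ ∷ _) e = All.lookup x∉ (∈-++⁺ˡ (subst (_∈ p ∷ P) e (end-∈ p P))) refl
    distinct []      []      (s≤s ())
    distinct P       (q ∷ Q) _ uniq = unique-++-apart (x ∷ P) uniq (end-∈ x P) (there (here refl))

does-true : ∀ {A : Set} (a? : Dec A) → does a? ≡ true → A
does-true (yes a) _ = a

unmap : ∀ {A B : Set} (f : A → B) (ys : List B) → (∀ {y} → y ∈ ys → ∃ λ x → f x ≡ y) → ∃ λ xs → map f xs ≡ ys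
unmap f []       _       = [] , refl
unmap f (y ∷ ys) preimage with preimage (here refl) | unmap f ys (preimage ∘ there)
... | x , refl | xs , refl = x ∷ xs , refl

_++ʷ_ : ∀ {G u v w} → Walk G u v → Walk G v w → Walk G u w
here       ++ʷ q = q
step a p   ++ʷ q = step a (p ++ʷ q)

SimplePath : (G : Graph) → List (Fin (size G)) → Set
SimplePath G xs = Linked (Adj G) xs × Unique xs

module GraphLemmas (G : Graph) (symmetric : Symmetric G) (irreflexive : Irreflexive G) where

  open import Data.List.Membership.DecPropositional (Fin._≟_ {size G}) using (_∈?_)

  V : Set
  V = Fin (size G)

  adj-sym : ∀ {u v} → Adj G u v → Adj G v u
  adj-sym {u} {v} u~v = trans (symmetric v u) u~v

  adj-irrefl : ∀ {u v} → Adj G u v → u ≢ v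
  adj-irrefl {u} u~v refl with trans (sym u~v) (irreflexive u)
  ... | ()

  degree-≥-distinct : ∀ v (L : List V) → Unique L → All (Adj G v) L → length L ≤ degree G v
  degree-≥-distinct v = countFin-≥-distinct (size G) (adj G v)

  degree-pos : ∀ {v w} → Adj G v w → 1 ≤ degree G v
  degree-pos {v} {w} v~w = degree-≥-distinct v [ w ] ([] ∷ []) (v~w ∷ [])

  degree-one : ∀ {v p} → (∀ y → Adj G v y → y ≡ p) → Adj G v p → degree G v ≡ 1
  degree-one {v} {p} only-p v~p = trans
    (sumFin-point (size G) (indicator ∘ adj G v) p not-adjacent)
    (cong indicator v~p)
    where
    not-adjacent : ∀ y → y ≢ p → indicator (adj G v y) ≡ 0
    not-adjacent y y≢p with adj G v y in v~y
    ... | true  = ⊥-elim (y≢p (only-p y v~y))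
    ... | false = refl

  neighbours-complete : ∀ v (L : List V) → Unique L → All (Adj G v) L → degree G v ≤ length L →
                        ∀ {w} → Adj G v w → w ∈ L
  neighbours-complete v L uniq v~L degree≤ {w} v~w with w ∈? L
  ... | yes w∈L = w∈L
  ... | no  w∉L = ⊥-elim (1+n≰n (≤-trans
                    (degree-≥-distinct v (w ∷ L) (¬Any⇒All¬ L w∉L ∷ uniq) (v~w ∷ v~L)) degree≤))

  pendant-neighbour-unique : ∀ {v x y} → degree G v ≤ 1 → Adj G v x → Adj G v y → x ≡ y
  pendant-neighbour-unique {v} {x} v≤1 v~x v~y with neighbours-complete v [ x ] ([] ∷ []) (v~x ∷ []) v≤1 v~y
  ... | here y≡x = sym y≡x

  confined : ∀ {v} → (∀ w → Adj G v w → degree G w ≤ 1) →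
             ∀ {x u} → x ≡ v ⊎ Adj G v x → Walk G x u → u ≡ v ⊎ Adj G v u
  confined pendants near                  here               = near
  confined pendants (inj₁ refl)           (step v~y walk)    = confined pendants (inj₂ v~y) walk
  confined pendants (inj₂ v~x)            (step x~y walk)    =
    confined pendants (inj₁ (pendant-neighbour-unique (pendants _ v~x) x~y (adj-sym v~x))) walk

  neighbours : ∀ v k → k ≤ degree G v → Σ (List V) λ L → length L ≡ k × Unique L × All (Adj G v) L
  neighbours v = countFin-witnesses (size G) (adj G v)

  neighbour : ∀ {v} → 1 ≤ degree G v → ∃ λ w → Adj G v w
  neighbour {v} = countFin-witness (size G) (adj G v)

  size-≥-2 : ∀ {u v} → Adj G u v → 2 ≤ size G
  size-≥-2 u~v = unique-length-≤ ((adj-irrefl u~v ∷ []) ∷ [] ∷ [])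

  other-neighbour : ∀ x p → (∃ λ y → Adj G x y × y ≢ p) ⊎ (∀ y → Adj G x y → y ≡ p)
  other-neighbour x p with Fin.any? (λ y → (adj G x y Bool.≟ true) ×-dec ¬? (y Fin.≟ p))
  ... | yes found = inj₁ found
  ... | no none   = inj₂ λ y x~y → decidable-stable (y Fin.≟ p) (λ y≢p → none (y , x~y , y≢p))

  walk-first : ∀ {u v} → Walk G u v → u ≢ v → ∃ λ w → Adj G u w
  walk-first here       u≢v = ⊥-elim (u≢v refl)
  walk-first (step a _) _   = _ , a

simple-suffix : ∀ {G} xs {ys} → SimplePath G (xs ++ ys) → SimplePath G ys
simple-suffix xs (linked , uniq) = linked-suffix xs linked , allPairs-suffix xs uniq

simple-prefix : ∀ {G} xs {ys} → SimplePath G (xs ++ ys) → SimplePath G xs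
simple-prefix xs (linked , uniq) = linked-prefix xs linked , allPairs-prefix xs uniq

module Acyclicity (G : Graph) (symmetric : Symmetric G) (irreflexive : Irreflexive G) (acyclic : Acyclic G) where

  open GraphLemmas G symmetric irreflexive public
  open import Data.List.Membership.DecPropositional (Fin._≟_ {size G}) using (_∈?_)

  no-chord : ∀ y z R x → SimplePath G (y ∷ z ∷ R) → x ∈ R → ¬ Adj G x y
  no-chord y z R x path x∈R x~y with ∈-∃++ x∈R
  ... | P , Q , refl with simple-prefix (y ∷ z ∷ P ++ [ x ])
                            (subst (SimplePath G) (cong (λ t → y ∷ z ∷ t) (sym (++-assoc P [ x ] Q))) path)
  ... | linked , uniq = acyclic y (z ∷ P ++ [ x ]) long uniq (linked-snoc (y ∷ z ∷ P) linked x~y)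
    where
    long : 2 ≤ length (z ∷ P ++ [ x ])
    long = s≤s (subst (1 ≤_) (sym (length-++ P)) (m≤n+m 1 (length P)))

  -- If y₁ lies on the second path, the edge h y₁ closes a cycle; otherwise both paths restart at y₁.
  paths-diverge : ∀ h y₁ y₂ R₁ R₂ → SimplePath G (h ∷ y₁ ∷ R₁) → SimplePath G (h ∷ y₂ ∷ R₂) →
                  y₁ ≢ y₂ → end y₁ R₁ ≢ end y₂ R₂
  paths-diverge h y₁ y₂ R₁ R₂ path₁@(h~y₁ ∷ _ , _) path₂ y₁≢y₂ with y₁ ∈? R₂
  ... | yes y₁∈R₂ = λ _ → no-chord h y₂ R₂ y₁ path₂ y₁∈R₂ (adj-sym h~y₁)
  ... | no  y₁∉R₂ = diverge R₁ path₁
    where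
    diverge : ∀ R₁ → SimplePath G (h ∷ y₁ ∷ R₁) → end y₁ R₁ ≢ end y₂ R₂
    diverge [] _ y₁≡end with subst (_∈ y₂ ∷ R₂) (sym y₁≡end) (end-∈ y₂ R₂)
    ... | here y₁≡y₂  = y₁≢y₂ y₁≡y₂
    ... | there y₁∈R₂ = y₁∉R₂ y₁∈R₂
    diverge (r ∷ R₁) (h~y₁ ∷ linked₁ , (h≢y₁ ∷ h≢r ∷ _) ∷ uniq₁) =
      paths-diverge y₁ r h R₁ (y₂ ∷ R₂) (linked₁ , uniq₁)
        (adj-sym h~y₁ ∷ proj₁ path₂ , ((h≢y₁ ∘ sym) ∷ y₁≢y₂ ∷ ¬Any⇒All¬ R₂ y₁∉R₂) ∷ proj₂ path₂)
        (h≢r ∘ sym)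

  off-path : ∀ A p x {y} → SimplePath G ((A ++ [ p ]) ++ [ x ]) → Adj G x y → y ≢ p → y ∉ (A ++ [ p ]) ++ [ x ]
  off-path A p x {y} path x~y y≢p y∈path with ∈-++⁻ (A ++ [ p ]) y∈path
  ... | inj₂ (here y≡x) = adj-irrefl x~y (sym y≡x)
  ... | inj₁ y∈A++p with ∈-++⁻ A y∈A++p
  ... | inj₂ (here y≡p) = y≢p y≡p
  ... | inj₁ y∈A with ∈-∃++ y∈A
  ... | B , C , refl = back-edge C (simple-suffix B (subst (SimplePath G) reassociate path))
    where
    reassociate : ((B ++ y ∷ C) ++ [ p ]) ++ [ x ] ≡ B ++ y ∷ (C ++ [ p ]) ++ [ x ]
    reassociate = trans (cong (_++ [ x ]) (++-assoc B (y ∷ C) [ p ])) (++-assoc B _ [ x ])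
    back-edge : ∀ C → SimplePath G (y ∷ (C ++ [ p ]) ++ [ x ]) → ⊥
    back-edge []      suffix = no-chord y p [ x ] x suffix (here refl) x~y
    back-edge (c ∷ C) suffix = no-chord y c ((C ++ [ p ]) ++ [ x ]) x suffix (∈-++⁺ʳ (C ++ [ p ]) (here refl)) x~y

  -- The fuel runs out only on a path longer than the number of vertices.
  extend-to-leaf : ∀ fuel A p x → SimplePath G ((A ++ [ p ]) ++ [ x ]) →
                   size G < length ((A ++ [ p ]) ++ [ x ]) + fuel →
                   Σ (List V) λ E → SimplePath G (((A ++ [ p ]) ++ [ x ]) ++ E) × degree G (end x E) ≡ 1
  extend-to-leaf zero A p x (_ , uniq) bound =
    ⊥-elim (<⇒≱ (subst (size G <_) (+-identityʳ _) bound) (unique-length-≤ uniq))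
  extend-to-leaf (suc fuel) A p x path@(linked , uniq) bound with other-neighbour x p
  ... | inj₂ only-p = [] , subst (SimplePath G) (sym (++-identityʳ _)) path ,
                      degree-one only-p (adj-sym (linked-last A linked))
  ... | inj₁ (y , x~y , y≢p) with extend-to-leaf fuel (A ++ [ p ]) x y longer bound′
    where
    xs : List V
    xs = (A ++ [ p ]) ++ [ x ]
    longer : SimplePath G (xs ++ [ y ])
    longer = linked-snoc (A ++ [ p ]) linked x~y ,
             Unique.++⁺ uniq ([] ∷ []) λ { (y∈xs , here refl) → off-path A p x path x~y y≢p y∈xs }
    bound′ : size G < length (xs ++ [ y ]) + fuel
    bound′ = subst (size G <_) (trans (sym (+-assoc (length xs) 1 fuel)) (cong (_+ fuel) (sym (length-++ xs)))) bound
  ... | E , path′ , leaf = y ∷ E , subst (SimplePath G) (++-assoc ((A ++ [ p ]) ++ [ x ]) [ y ] E) path′ , leaf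

  path-to-leaf : ∀ c w → Adj G c w → Σ (List V) λ E → SimplePath G (c ∷ w ∷ E) × degree G (end w E) ≡ 1
  path-to-leaf c w c~w = extend-to-leaf (size G) [] c w (c~w ∷ [-] , ((adj-irrefl c~w ∷ []) ∷ [] ∷ [])) (n≤1+n (suc (size G)))

  leaf-beyond : ∀ c w → Adj G c w → V
  leaf-beyond c w c~w = end w (proj₁ (path-to-leaf c w c~w))

  leaf-beyond-is-leaf : ∀ c w (c~w : Adj G c w) → degree G (leaf-beyond c w c~w) ≡ 1
  leaf-beyond-is-leaf c w c~w = proj₂ (proj₂ (path-to-leaf c w c~w))

  leaf-beyond-injective : ∀ c {w₁ w₂} (c~w₁ : Adj G c w₁) (c~w₂ : Adj G c w₂) → w₁ ≢ w₂ →
                          leaf-beyond c w₁ c~w₁ ≢ leaf-beyond c w₂ c~w₂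
  leaf-beyond-injective c {w₁} {w₂} c~w₁ c~w₂ =
    paths-diverge c w₁ w₂ _ _ (proj₁ (proj₂ (path-to-leaf c w₁ c~w₁))) (proj₁ (proj₂ (path-to-leaf c w₂ c~w₂)))

  leaves-≥-distinct : (L : List V) → Unique L → All (λ v → degree G v ≡ 1) L → length L ≤ leaves G
  leaves-≥-distinct L uniq leaf = countFin-≥-distinct (size G) (λ v → degree G v ≡ᵇ 1) L uniq
    (All.map (cong (_≡ᵇ 1)) leaf)

  opposite-ends-distinct : ∀ {u w} E₁ E₂ → SimplePath G (u ∷ w ∷ E₁) → SimplePath G (w ∷ u ∷ E₂) →
                           end w E₁ ≢ end u E₂
  opposite-ends-distinct {u} {w} E₁ [] (_ , (u∉ ∷ _)) _ end≡u =
    All.lookup u∉ (subst (_∈ w ∷ E₁) end≡u (end-∈ w E₁)) refl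
  opposite-ends-distinct {u} {w} E₁ (e ∷ E₂) path₁ (_ ∷ linked , (_ ∷ w≢e ∷ _) ∷ uniq) =
    paths-diverge u w e E₁ E₂ path₁ (linked , uniq) w≢e

  two-leaves : ∀ {u w} → Adj G u w → 2 ≤ leaves G
  two-leaves {u} {w} u~w = leaves-≥-distinct (leaf-beyond u w u~w ∷ leaf-beyond w u w~u ∷ [])
    ((opposite-ends-distinct _ _ (proj₁ (proj₂ (path-to-leaf u w u~w))) (proj₁ (proj₂ (path-to-leaf w u w~u))) ∷ [])
      ∷ [] ∷ [])
    (leaf-beyond-is-leaf u w u~w ∷ leaf-beyond-is-leaf w u w~u ∷ [])
    where
    w~u : Adj G w u
    w~u = adj-sym u~w

  three-leaves : ∀ {c} → 3 ≤ degree G c → 3 ≤ leaves G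
  three-leaves {c} branch = three (neighbours c 3 branch)
    where
    three : (Σ (List V) λ L → length L ≡ 3 × Unique L × All (Adj G c) L) → 3 ≤ leaves G
    three (w₁ ∷ w₂ ∷ w₃ ∷ [] , _ , (w₁≢w₂ ∷ w₁≢w₃ ∷ []) ∷ (w₂≢w₃ ∷ []) ∷ [] ∷ [] ,
           c~w₁ ∷ c~w₂ ∷ c~w₃ ∷ []) =
      leaves-≥-distinct (leaf-beyond c w₁ c~w₁ ∷ leaf-beyond c w₂ c~w₂ ∷ leaf-beyond c w₃ c~w₃ ∷ [])
        ((leaf-beyond-injective c c~w₁ c~w₂ w₁≢w₂ ∷ leaf-beyond-injective c c~w₁ c~w₃ w₁≢w₃ ∷ []) ∷
         (leaf-beyond-injective c c~w₂ c~w₃ w₂≢w₃ ∷ []) ∷ [] ∷ [])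
        (leaf-beyond-is-leaf c w₁ c~w₁ ∷ leaf-beyond-is-leaf c w₂ c~w₂ ∷ leaf-beyond-is-leaf c w₃ c~w₃ ∷ [])

module _ {G : Graph} where

  tree-symmetric : IsTree G → Symmetric G
  tree-symmetric (_ , symmetric , _) = symmetric

  tree-irreflexive : IsTree G → Irreflexive G
  tree-irreflexive (_ , _ , irreflexive , _) = irreflexive

  tree-connected : IsTree G → Connected G
  tree-connected (_ , _ , _ , connected , _) = connected

  tree-acyclic : IsTree G → Acyclic G
  tree-acyclic (_ , _ , _ , _ , acyclic) = acyclic

module TreeLemmas {G : Graph} (tree : IsTree G) =
  Acyclicity G (tree-symmetric tree) (tree-irreflexive tree) (tree-acyclic tree)

countVertices : (G : Graph) → (ℕ → Bool) → ℕ
countVertices G φ = countFin (size G) (φ ∘ degree G)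

record Gluing (T S T′ : Graph) (vs : Fin (size S)) (vt : Fin (size T′)) : Set where
  field
    σ           : Fin (size S) → Fin (size T)
    τ           : Fin (size T′) → Fin (size T)
    σ-injective : Injective _≡_ _≡_ σ
    τ-injective : Injective _≡_ _≡_ τ
    glued       : σ vs ≡ τ vt
    meet        : ∀ a b → σ a ≡ τ b → a ≡ vs × b ≡ vt
    cover       : ∀ x → (∃ λ a → σ a ≡ x) ⊎ (∃ λ b → τ b ≡ x)
    adj-σ       : ∀ a b → adj T (σ a) (σ b) ≡ adj S a b
    adj-τ       : ∀ a b → adj T (τ a) (τ b) ≡ adj T′ a b
    adj-cross   : ∀ a b → a ≢ vs → b ≢ vt → adj T (σ a) (τ b) ≡ false × adj T (τ b) (σ a) ≡ false

fromGlue : ∀ {T S T′ vs vt} → Glue T S T′ vs vt → Gluing T S T′ vs vt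
fromGlue (σ , τ , σ-injective , τ-injective , glued , meet , cover , adj-σ , adj-τ , adj-cross) =
  record { σ = σ ; τ = τ ; σ-injective = σ-injective ; τ-injective = τ-injective ; glued = glued
         ; meet = meet ; cover = cover ; adj-σ = adj-σ ; adj-τ = adj-τ ; adj-cross = adj-cross }

module GluingLemmas {T S T′ : Graph} {vs : Fin (size S)} {vt : Fin (size T′)} (gluing : Gluing T S T′ vs vt) where

  open Gluing gluing public

  private
    ≢vs? : ∀ a → Dec (a ≢ vs)
    ≢vs? a = ¬? (a Fin.≟ vs)

    others : List (Fin (size S))
    others = filter ≢vs? (allFin (size S))

    others-unique : Unique others
    others-unique = Unique.filter⁺ ≢vs? (Unique.allFin⁺ (size S))

    others-≢ : ∀ {a} → a ∈ others → a ≢ vs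
    others-≢ a∈ = proj₂ (∈-filter⁻ ≢vs? {xs = allFin (size S)} a∈)

    others-∋ : ∀ {a} → a ≢ vs → a ∈ others
    others-∋ = ∈-filter⁺ ≢vs? (∈-allFin _)

    S-enumeration : ∀ a → a ∈ vs ∷ others
    S-enumeration a with a Fin.≟ vs
    ... | yes refl = here refl
    ... | no a≢vs = there (others-∋ a≢vs)

    T-list : List (Fin (size T))
    T-list = map σ others ++ map τ (allFin (size T′))

    T-enumeration : ∀ x → x ∈ T-list
    T-enumeration x with cover x
    ... | inj₂ (b , refl) = ∈-++⁺ʳ (map σ others) (∈-map⁺ τ (∈-allFin b))
    ... | inj₁ (a , refl) with a Fin.≟ vs
    ... | yes refl = subst (_∈ T-list) (sym glued) (∈-++⁺ʳ (map σ others) (∈-map⁺ τ (∈-allFin vt)))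
    ... | no a≢vs = ∈-++⁺ˡ (∈-map⁺ σ (others-∋ a≢vs))

    T-enumeration-unique : Unique (map σ others ++ map τ (allFin (size T′)))
    T-enumeration-unique = Unique.++⁺ (Unique.map⁺ σ-injective others-unique)
      (Unique.map⁺ τ-injective (Unique.allFin⁺ (size T′))) disjoint
      where
      disjoint : ∀ {x} → ¬ (x ∈ map σ others × x ∈ map τ (allFin (size T′)))
      disjoint (x∈σ , x∈τ) with ∈-map⁻ σ x∈σ | ∈-map⁻ τ x∈τ
      ... | a , a∈others , refl | b , _ , σa≡τb = others-≢ a∈others (proj₁ (meet a b σa≡τb))

  -- The glued vertex is seen from both sides, hence the extra h vs on the left.
  sumFin-glued : (f : Fin (size T) → ℕ) (h : Fin (size S) → ℕ) → (∀ a → a ≢ vs → h a ≡ f (σ a)) →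
                 sumFin (size T) f + h vs ≡ sumFin (size S) h + sumFin (size T′) (f ∘ τ)
  sumFin-glued f h h≡f = begin
    sumFin (size T) f + h vs
      ≡⟨ cong (_+ h vs) (sumFin-enumeration f _ T-enumeration-unique T-enumeration) ⟩
    sum (map f (map σ others ++ map τ (allFin (size T′)))) + h vs
      ≡⟨ cong (λ xs → sum xs + h vs) (map-++ f (map σ others) _) ⟩
    sum (map f (map σ others) ++ map f (map τ (allFin (size T′)))) + h vs
      ≡⟨ cong (_+ h vs) (sum-++ (map f (map σ others)) _) ⟩
    sum (map f (map σ others)) + sum (map f (map τ (allFin (size T′)))) + h vs
      ≡⟨ cong (λ xs → sum (map f (map σ others)) + sum xs + h vs) (sym (map-∘ (allFin (size T′)))) ⟩
    sum (map f (map σ others)) + sumFin (size T′) (f ∘ τ) + h vs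
      ≡⟨ cong (λ xs → sum xs + _ + h vs) (trans (sym (map-∘ others)) (sym (map-cong-local h≡f-on-others))) ⟩
    sum (map h others) + sumFin (size T′) (f ∘ τ) + h vs
      ≡⟨ solve 3 (λ x y z → x :+ y :+ z := z :+ x :+ y) refl (sum (map h others)) _ (h vs) ⟩
    h vs + sum (map h others) + sumFin (size T′) (f ∘ τ)
      ≡⟨ cong (_+ _) (sym (sumFin-enumeration h (vs ∷ others)
           (All.tabulate (λ a∈ → others-≢ a∈ ∘ sym) ∷ others-unique) S-enumeration)) ⟩
    sumFin (size S) h + sumFin (size T′) (f ∘ τ) ∎
    where
    open ≡-Reasoning
    h≡f-on-others : All (λ a → h a ≡ f (σ a)) others
    h≡f-on-others = All.tabulate (λ a∈ → h≡f _ (others-≢ a∈))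

  glue : Fin (size T)
  glue = τ vt

  degree-σ : ∀ a₀ → a₀ ≢ vs → degree T (σ a₀) ≡ degree S a₀
  degree-σ a₀ a₀≢vs = +-cancelʳ-≡ _ _ _ (begin
    degree T (σ a₀) + indicator (adj S a₀ vs)
      ≡⟨ sumFin-glued (indicator ∘ adj T (σ a₀)) (indicator ∘ adj S a₀) (λ a _ → cong indicator (sym (adj-σ a₀ a))) ⟩
    degree S a₀ + sumFin (size T′) (indicator ∘ adj T (σ a₀) ∘ τ)
      ≡⟨ cong (degree S a₀ +_)
           (sumFin-point (size T′) _ vt (λ b b≢vt → cong indicator (proj₁ (adj-cross a₀ b a₀≢vs b≢vt)))) ⟩
    degree S a₀ + indicator (adj T (σ a₀) (τ vt))
      ≡⟨ cong (λ x → degree S a₀ + indicator (adj T (σ a₀) x)) (sym glued) ⟩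
    degree S a₀ + indicator (adj T (σ a₀) (σ vs))
      ≡⟨ cong (λ b → degree S a₀ + indicator b) (adj-σ a₀ vs) ⟩
    degree S a₀ + indicator (adj S a₀ vs) ∎)
    where open ≡-Reasoning

  degree-τ : ∀ b₀ → b₀ ≢ vt → degree T (τ b₀) ≡ degree T′ b₀
  degree-τ b₀ b₀≢vt = begin
    degree T (τ b₀)                                      ≡⟨ sym (+-identityʳ _) ⟩
    degree T (τ b₀) + 0
      ≡⟨ sumFin-glued (indicator ∘ adj T (τ b₀)) (λ _ → 0)
           (λ a a≢vs → cong indicator (sym (proj₂ (adj-cross a b₀ a≢vs b₀≢vt)))) ⟩
    sumFin (size S) (λ _ → 0) + sumFin (size T′) (indicator ∘ adj T (τ b₀) ∘ τ)
      ≡⟨ cong₂ _+_ (sumFin-zero (size S) (λ _ → refl)) (sumFin-cong (size T′) (cong indicator ∘ adj-τ b₀)) ⟩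
    degree T′ b₀                                         ∎
    where open ≡-Reasoning

  degree-glue : Irreflexive S → degree T glue ≡ degree S vs + degree T′ vt
  degree-glue irreflexive-S = begin
    degree T glue                                        ≡⟨ sym (+-identityʳ _) ⟩
    degree T glue + 0                                    ≡⟨ cong (λ b → degree T glue + indicator b) (sym (irreflexive-S vs)) ⟩
    degree T glue + indicator (adj S vs vs)
      ≡⟨ sumFin-glued (indicator ∘ adj T glue) (indicator ∘ adj S vs)
           (λ a _ → cong indicator (sym (trans (cong (λ x → adj T x (σ a)) (sym glued)) (adj-σ vs a)))) ⟩
    degree S vs + sumFin (size T′) (indicator ∘ adj T glue ∘ τ)
      ≡⟨ cong (degree S vs +_) (sumFin-cong (size T′) (cong indicator ∘ adj-τ vt)) ⟩
    degree S vs + degree T′ vt                           ∎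
    where open ≡-Reasoning

  countVertices-glued : ∀ φ →
    countVertices T φ + indicator (φ (degree S vs)) + indicator (φ (degree T′ vt)) ≡
    countVertices S φ + countVertices T′ φ + indicator (φ (degree T glue))
  countVertices-glued φ = begin
    countVertices T φ + indicator (φ (degree S vs)) + indicator (φ (degree T′ vt))
      ≡⟨ cong (_+ indicator (φ (degree T′ vt)))
           (sumFin-glued (indicator ∘ φ ∘ degree T) (indicator ∘ φ ∘ degree S)
             (λ a a≢vs → cong (indicator ∘ φ) (sym (degree-σ a a≢vs)))) ⟩
    countVertices S φ + sumFin (size T′) (indicator ∘ φ ∘ degree T ∘ τ) + indicator (φ (degree T′ vt))
      ≡⟨ +-assoc (countVertices S φ) _ _ ⟩
    countVertices S φ + (sumFin (size T′) (indicator ∘ φ ∘ degree T ∘ τ) + indicator (φ (degree T′ vt)))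
      ≡⟨ cong (countVertices S φ +_)
           (sumFin-update (size T′) _ (indicator ∘ φ ∘ degree T′) vt
             (λ b b≢vt → cong (indicator ∘ φ) (degree-τ b b≢vt))) ⟩
    countVertices S φ + (countVertices T′ φ + indicator (φ (degree T glue)))
      ≡⟨ sym (+-assoc (countVertices S φ) _ _) ⟩
    countVertices S φ + countVertices T′ φ + indicator (φ (degree T glue)) ∎
    where open ≡-Reasoning

  classify : ∀ x → (∃ λ a → a ≢ vs × σ a ≡ x) ⊎ (∃ λ b → τ b ≡ x)
  classify x with cover x
  ... | inj₂ τ-image = inj₂ τ-image
  ... | inj₁ (a , σa≡x) with a Fin.≟ vs
  ... | yes refl = inj₂ (vt , trans (sym glued) σa≡x)
  ... | no a≢vs = inj₁ (a , a≢vs , σa≡x)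

  adj-τ⁺ : ∀ {b b′} → Adj T′ b b′ → Adj T (τ b) (τ b′)
  adj-τ⁺ {b} {b′} b~b′ = trans (adj-τ b b′) b~b′

  degree-τ-≤ : Irreflexive S → ∀ b → degree T′ b ≤ degree T (τ b)
  degree-τ-≤ irreflexive-S b with b Fin.≟ vt
  ... | yes refl = subst (degree T′ vt ≤_) (sym (degree-glue irreflexive-S)) (m≤n+m _ _)
  ... | no b≢vt = ≤-reflexive (sym (degree-τ b b≢vt))

  neighbour-of-τ : ∀ {b x} → b ≢ vt → Adj T (τ b) x → ∃ λ b′ → τ b′ ≡ x × Adj T′ b b′
  neighbour-of-τ {b} {x} b≢vt τb~x with classify x
  ... | inj₂ (b′ , refl) = b′ , refl , trans (sym (adj-τ b b′)) τb~x
  ... | inj₁ (a , a≢vs , refl) with trans (sym τb~x) (proj₂ (adj-cross a b a≢vs b≢vt))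
  ... | ()

  neighbour-of-glue : ∀ {x} → Adj T glue x →
                      (∃ λ a → σ a ≡ x × Adj S vs a) ⊎ (∃ λ b′ → τ b′ ≡ x × Adj T′ vt b′)
  neighbour-of-glue {x} g~x with classify x
  ... | inj₂ (b′ , refl) = inj₂ (b′ , refl , trans (sym (adj-τ vt b′)) g~x)
  ... | inj₁ (a , _ , refl) = inj₁ (a , refl , trans (sym (adj-σ vs a)) (subst (λ y → Adj T y (σ a)) (sym glued) g~x))

record StarlikeSplitting (T S T′ : Graph) (vs : Fin (size S)) (vt : Fin (size T′)) : Set where
  field
    two-branch : TwoBranch T
    tree-S     : IsTree S
    tree-T′    : IsTree T′
    c          : Fin (size S)
    c-centre   : IsCentre S c
    vs-leaf    : degree S vs ≡ 1
    c~vs       : Adj S c vs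
    gluing     : Gluing T S T′ vs vt

fromSplitting : ∀ {T S T′ vs vt} → Splitting T S T′ vs vt → StarlikeSplitting T S T′ vs vt
fromSplitting (two-branch , (tree-S , _) , tree-T′ , (c , c-centre , vs-leaf , c~vs) , glue) = record
  { two-branch = two-branch ; tree-S = tree-S ; tree-T′ = tree-T′ ; c = c ; c-centre = c-centre
  ; vs-leaf = vs-leaf ; c~vs = c~vs ; gluing = fromGlue glue }

module SplittingLemmas {T S T′ : Graph} {vs : Fin (size S)} {vt : Fin (size T′)}
  (splitting : StarlikeSplitting T S T′ vs vt) where

  open StarlikeSplitting splitting public
  open GluingLemmas gluing public
  module S = TreeLemmas tree-S
  module T′ = TreeLemmas tree-T′

  c≢vs : c ≢ vs
  c≢vs c≡vs with subst (3 ≤_) (trans (cong (degree S) c≡vs) vs-leaf) (proj₁ c-centre)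
  ... | s≤s ()

  σc-branch : 3 ≤ degree T (σ c)
  σc-branch = subst (3 ≤_) (sym (degree-σ c c≢vs)) (proj₁ c-centre)

  σc~glue : Adj T (σ c) glue
  σc~glue = trans (cong (adj T (σ c)) (sym glued)) (trans (adj-σ c vs) c~vs)

  degree-glue-suc : degree T glue ≡ suc (degree T′ vt)
  degree-glue-suc = trans (degree-glue (tree-irreflexive tree-S)) (cong (_+ degree T′ vt) vs-leaf)

  branch-in-S-is-σc : ∀ a → a ≢ vs → 3 ≤ degree T (σ a) → σ a ≡ σ c
  branch-in-S-is-σc a a≢vs branch = cong σ (proj₂ c-centre a (subst (3 ≤_) (degree-σ a a≢vs) branch))

  vt-not-isolated-if-branch : ∀ x → 3 ≤ degree T x → x ≢ σ c → 1 ≤ degree T′ vt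
  vt-not-isolated-if-branch x branch x≢σc with classify x
  ... | inj₁ (a , a≢vs , refl) = ⊥-elim (x≢σc (branch-in-S-is-σc a a≢vs branch))
  ... | inj₂ (b , refl) with b Fin.≟ vt
  ... | yes refl = ≤-trans (s≤s z≤n) (≤-pred (subst (3 ≤_) degree-glue-suc branch))
  ... | no b≢vt = T′.degree-pos (proj₂ (T′.walk-first (tree-connected tree-T′ vt b) (b≢vt ∘ sym)))

  vt-not-isolated : 1 ≤ degree T′ vt
  vt-not-isolated with two-branch
  ... | u , v , u≢v , u-branch , v-branch with u Fin.≟ σ c
  ... | yes refl = vt-not-isolated-if-branch v v-branch (u≢v ∘ sym)
  ... | no u≢σc = vt-not-isolated-if-branch u u-branch u≢σc

  T′-nontrivial : 2 ≤ size T′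
  T′-nontrivial = T′.size-≥-2 (proj₂ (T′.neighbour vt-not-isolated))

  leaves-glued : leaves T + 1 + indicator (degree T′ vt ≡ᵇ 1) ≡ leaves S + leaves T′
  leaves-glued = begin
    leaves T + 1 + indicator (degree T′ vt ≡ᵇ 1)
      ≡⟨ cong (λ d → leaves T + indicator (d ≡ᵇ 1) + indicator (degree T′ vt ≡ᵇ 1)) (sym vs-leaf) ⟩
    leaves T + indicator (degree S vs ≡ᵇ 1) + indicator (degree T′ vt ≡ᵇ 1)
      ≡⟨ countVertices-glued (_≡ᵇ 1) ⟩
    leaves S + leaves T′ + indicator (degree T glue ≡ᵇ 1)
      ≡⟨ cong (λ d → leaves S + leaves T′ + indicator (d ≡ᵇ 1)) degree-glue-suc ⟩
    leaves S + leaves T′ + indicator (suc (degree T′ vt) ≡ᵇ 1)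
      ≡⟨ cong (λ b → leaves S + leaves T′ + indicator b) (not-leaf (s≤s vt-not-isolated)) ⟩
    leaves S + leaves T′ + 0
      ≡⟨ +-identityʳ _ ⟩
    leaves S + leaves T′ ∎
    where open ≡-Reasoning

  irregular-glue-branch : (degree T′ vt ≡ᵇ 1) ≡ false → 3 ≤ degree T glue
  irregular-glue-branch irregular = subst (3 ≤_) (sym degree-glue-suc) (s≤s (at-least-two vt-not-isolated irregular))
    where
    at-least-two : ∀ {d} → 1 ≤ d → (d ≡ᵇ 1) ≡ false → 2 ≤ d
    at-least-two {suc (suc d)} _ _ = s≤s (s≤s z≤n)

  adjacent-branches-lift : AdjacentBranches T′ → AdjacentBranches T
  adjacent-branches-lift (u , v , u~v , u-branch , v-branch) = τ u , τ v , adj-τ⁺ u~v ,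
    ≤-trans u-branch (degree-τ-≤ (tree-irreflexive tree-S) u) , ≤-trans v-branch (degree-τ-≤ (tree-irreflexive tree-S) v)

  branch-if-regular : degree T′ vt ≡ 1 → ∀ x → 3 ≤ degree T x →
                      x ≡ σ c ⊎ ∃ λ b → b ≢ vt × τ b ≡ x × 3 ≤ degree T′ b
  branch-if-regular regular x branch with classify x
  ... | inj₁ (a , a≢vs , refl) = inj₁ (branch-in-S-is-σc a a≢vs branch)
  ... | inj₂ (b , refl) with b Fin.≟ vt
  ... | no b≢vt = inj₂ (b , b≢vt , refl , subst (3 ≤_) (degree-τ b b≢vt) branch)
  ... | yes refl with subst (3 ≤_) (trans degree-glue-suc (cong suc regular)) branch
  ...   | s≤s (s≤s ())

  adjacent-branches-if-regular : degree T′ vt ≡ 1 → AdjacentBranches T → AdjacentBranches T′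
  adjacent-branches-if-regular regular (u , v , u~v , u-branch , v-branch)
    with branch-if-regular regular u u-branch | branch-if-regular regular v v-branch
  ... | inj₁ refl | inj₁ refl with trans (sym u~v) (trans (adj-σ c c) (tree-irreflexive tree-S c))
  ...   | ()
  adjacent-branches-if-regular regular (u , v , u~v , u-branch , v-branch)
      | inj₁ refl | inj₂ (b , b≢vt , refl , _) with trans (sym u~v) (proj₁ (adj-cross c b c≢vs b≢vt))
  ...   | ()
  adjacent-branches-if-regular regular (u , v , u~v , u-branch , v-branch)
      | inj₂ (b , b≢vt , refl , _) | inj₁ refl with trans (sym u~v) (proj₂ (adj-cross c b c≢vs b≢vt))
  ...   | ()
  adjacent-branches-if-regular regular (u , v , u~v , u-branch , v-branch)
      | inj₂ (b , _ , refl , b-branch) | inj₂ (b′ , _ , refl , b′-branch) =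
    b , b′ , trans (sym (adj-τ b b′)) u~v , b-branch , b′-branch

  adjacent-branches-step : ∀ k → (0 < k → AdjacentBranches T′) → 0 < irregularity T′ vt + k → AdjacentBranches T
  adjacent-branches-step k ih pos with degree T′ vt ≡ᵇ 1 in regular
  ... | true  = adjacent-branches-lift (ih pos)
  ... | false = σ c , glue , σc~glue , σc-branch , irregular-glue-branch regular

  irregular-step : ∀ k → (AdjacentBranches T′ → 0 < k) → AdjacentBranches T → 0 < irregularity T′ vt + k
  irregular-step k ih branches with degree T′ vt ≡ᵇ 1 in regular
  ... | true  = ih (adjacent-branches-if-regular (≡ᵇ-true regular) branches)
  ... | false = s≤s z≤n

leaves-bound-step : ∀ {lT lS lT′} k b → lT + 1 + indicator b ≡ lS + lT′ → 3 ≤ lS → 2 * k + 2 ≤ lT′ →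
                    2 * ((if b then 0 else 1) + k) + 2 ≤ lT
leaves-bound-step {lT} {lS} {lT′} k true glued lS≥3 lT′≥ = +-cancelʳ-≤ 2 _ _ (begin
  2 * k + 2 + 2       ≤⟨ n≤1+n _ ⟩
  suc (2 * k + 2 + 2) ≡⟨ solve 1 (λ k → con 1 :+ (con 2 :* k :+ con 2 :+ con 2) := con 3 :+ (con 2 :* k :+ con 2)) refl k ⟩
  3 + (2 * k + 2)     ≤⟨ +-mono-≤ lS≥3 lT′≥ ⟩
  lS + lT′            ≡⟨ sym glued ⟩
  lT + 1 + 1          ≡⟨ +-assoc lT 1 1 ⟩
  lT + 2              ∎)
  where open ≤-Reasoning
leaves-bound-step {lT} {lS} {lT′} k false glued lS≥3 lT′≥ = +-cancelʳ-≤ 1 _ _ (begin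
  2 * (1 + k) + 2 + 1 ≡⟨ solve 1 (λ k → con 2 :* (con 1 :+ k) :+ con 2 :+ con 1 := con 3 :+ (con 2 :* k :+ con 2)) refl k ⟩
  3 + (2 * k + 2)     ≤⟨ +-mono-≤ lS≥3 lT′≥ ⟩
  lS + lT′            ≡⟨ sym glued ⟩
  lT + 1 + 0          ≡⟨ +-identityʳ _ ⟩
  lT + 1              ∎)
  where open ≤-Reasoning

two-distinct : ∀ m → 2 ≤ m → Σ (Fin m) λ i → Σ (Fin m) λ j → i ≢ j
two-distinct (suc zero)    (s≤s ())
two-distinct (suc (suc m)) _ = fzero , fsuc fzero , λ ()

leaves-lower-bound : (T : Graph) → IsTree T → 2 ≤ size T → (k : ℕ) → Iota T k → 2 * k + 2 ≤ leaves T
leaves-lower-bound T _ _ _ (stop (inj₁ (tree , _ , centre))) =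
  ≤-trans (n≤1+n 2) (TreeLemmas.three-leaves tree (proj₁ centre))
leaves-lower-bound T tree size≥2 _ (stop (inj₂ _)) with two-distinct (size T) size≥2
... | i , j , i≢j = TreeLemmas.two-leaves tree (proj₂ (TreeLemmas.walk-first tree (tree-connected tree i j) i≢j))
leaves-lower-bound T _ _ _ (split {T' = T′} {vt = vt} {k = k} splitting decomposition) =
  leaves-bound-step k (degree T′ vt ≡ᵇ 1) leaves-glued (S.three-leaves (proj₁ c-centre))
    (leaves-lower-bound T′ tree-T′ T′-nontrivial k decomposition)
  where open SplittingLemmas (fromSplitting splitting)

degree-pathGraph-≤ : ∀ n (i : Fin n) → degree (pathGraph n) i ≤ 2
degree-pathGraph-≤ n i = ≤-trans (countFin-∨ n below above) (+-mono-≤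
  (countFin-≤-1 n below (λ x-below y-below →
     Fin.toℕ-injective (suc-injective (trans (sym (≡ᵇ-true {toℕ i} x-below)) (≡ᵇ-true y-below)))))
  (countFin-≤-1 n above (λ x-above y-above →
     Fin.toℕ-injective (trans (≡ᵇ-true x-above) (sym (≡ᵇ-true y-above))))))
  where
  below above : Fin n → Bool
  below j = toℕ i ≡ᵇ suc (toℕ j)
  above j = toℕ j ≡ᵇ suc (toℕ i)

degree-iso : ∀ {G H} ((f , adj-f) : Iso G H) i → degree G i ≡ degree H (Inverse.to f i)
degree-iso {G} {H} (f , adj-f) i = begin
  degree G i
    ≡⟨ sumFin-cong (size G) (λ j → cong indicator (sym (adj-f i j))) ⟩
  sumFin (size G) (indicator ∘ adj H (to i) ∘ to)
    ≡⟨ cong sum (map-∘ (allFin (size G))) ⟩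
  sum (map (indicator ∘ adj H (to i)) (map to (allFin (size G))))
    ≡⟨ sym (sumFin-enumeration _ (map to (allFin (size G))) (Unique.map⁺ to-injective (Unique.allFin⁺ (size G))) reached) ⟩
  degree H (to i) ∎
  where
  open ≡-Reasoning
  open Inverse f using (to; from; strictlyInverseˡ; strictlyInverseʳ)
  to-injective : ∀ {x y} → to x ≡ to y → x ≡ y
  to-injective {x} {y} tx≡ty = trans (sym (strictlyInverseʳ x)) (trans (cong from tx≡ty) (strictlyInverseʳ y))
  reached : ∀ y → y ∈ map to (allFin (size G))
  reached y = subst (λ z → z ∈ _) (strictlyInverseˡ y) (∈-map⁺ to (∈-allFin (from y)))

degree-path-≤ : ∀ {G} → IsPath G → ∀ i → degree G i ≤ 2
degree-path-≤ {G} (n , iso) i = subst (_≤ 2) (sym (degree-iso {G} {pathGraph n} iso i)) (degree-pathGraph-≤ n _)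

adjacent-branches-if-irregular : (T : Graph) (k : ℕ) → Iota T k → 0 < k → AdjacentBranches T
adjacent-branches-if-irregular T _ (stop _) ()
adjacent-branches-if-irregular T _ (split {T' = T′} {k = k} splitting decomposition) =
  adjacent-branches-step k (adjacent-branches-if-irregular T′ k decomposition)
  where open SplittingLemmas (fromSplitting splitting)

irregular-if-adjacent-branches : (T : Graph) (k : ℕ) → Iota T k → AdjacentBranches T → 0 < k
irregular-if-adjacent-branches T _ (stop (inj₁ (tree , c , _ , only-c))) (u , v , u~v , u-branch , v-branch)
  with only-c u u-branch | only-c v v-branch
... | refl | refl = ⊥-elim (TreeLemmas.adj-irrefl tree u~v refl)
irregular-if-adjacent-branches T _ (stop (inj₂ (_ , path))) (u , _ , _ , u-branch , _) =
  ⊥-elim (<⇒≱ (s≤s (degree-path-≤ path u)) u-branch)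
irregular-if-adjacent-branches T _ (split {T' = T′} {k = k} splitting decomposition) =
  irregular-step k (irregular-if-adjacent-branches T′ k decomposition)
  where open SplittingLemmas (fromSplitting splitting)

branches : Graph → ℕ
branches G = countVertices G (3 ≤ᵇ_)

HasTwoPendants : (G : Graph) → Fin (size G) → Set
HasTwoPendants G v = Σ (Fin (size G)) λ w₁ → Σ (Fin (size G)) λ w₂ →
  w₁ ≢ w₂ × Adj G v w₁ × Adj G v w₂ × degree G w₁ ≤ 1 × degree G w₂ ≤ 1

module _ {G : Graph} (tree : IsTree G) where

  open TreeLemmas tree

  two-pendants-degree : ∀ {v} → HasTwoPendants G v → 2 ≤ degree G v
  two-pendants-degree {v} (w₁ , w₂ , w₁≢w₂ , v~w₁ , v~w₂ , _) =
    degree-≥-distinct v (w₁ ∷ w₂ ∷ []) ((w₁≢w₂ ∷ []) ∷ [] ∷ []) (v~w₁ ∷ v~w₂ ∷ [])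

  only-pendants : ∀ {v} → HasTwoPendants G v → degree G v ≡ 2 → ∀ {w} → Adj G v w → degree G w ≤ 1
  only-pendants {v} (w₁ , w₂ , w₁≢w₂ , v~w₁ , v~w₂ , w₁-pendant , w₂-pendant) deg-v v~w
    with neighbours-complete v (w₁ ∷ w₂ ∷ []) ((w₁≢w₂ ∷ []) ∷ [] ∷ []) (v~w₁ ∷ v~w₂ ∷ [])
           (≤-reflexive deg-v) v~w
  ... | here refl         = w₁-pendant
  ... | there (here refl) = w₂-pendant

record Rigid (G : Graph) : Set where
  field
    branch-pendants     : ∀ v → 3 ≤ degree G v → HasTwoPendants G v
    degree-two-isolated : ∀ v w → degree G v ≡ 2 → Adj G v w → degree G w < 3

is-branch : ∀ {d} → 3 ≤ d → (3 ≤ᵇ d) ≡ true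
is-branch (s≤s (s≤s (s≤s _))) = refl

not-branch : ∀ {d} → d < 3 → indicator (3 ≤ᵇ d) ≡ 0
not-branch {0} _ = refl
not-branch {1} _ = refl
not-branch {2} _ = refl
not-branch {suc (suc (suc _))} (s≤s (s≤s (s≤s ())))

branches-starlike : ∀ {G c} → IsCentre G c → branches G ≡ 1
branches-starlike {G} {c} (c-branch , only-c) =
  trans (sumFin-point (size G) _ c (λ v v≢c → not-branch (≰⇒> (v≢c ∘ only-c v)))) (cong indicator (is-branch c-branch))

branches-none : ∀ {G} → (∀ v → degree G v < 3) → branches G ≡ 0
branches-none {G} small = sumFin-zero (size G) (not-branch ∘ small)

branches-pos : ∀ {G} v → 3 ≤ degree G v → 1 ≤ branches G
branches-pos {G} v branch = countFin-≥-distinct (size G) ((3 ≤ᵇ_) ∘ degree G) (v ∷ []) ([] ∷ [])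
  (is-branch branch ∷ [])

module RigidSplitting {T S T′ : Graph} {vs : Fin (size S)} {vt : Fin (size T′)}
  (splitting : StarlikeSplitting T S T′ vs vt) (rigid : Rigid T) where

  open SplittingLemmas splitting
  open Rigid rigid

  glue~σc : Adj T glue (σ c)
  glue~σc = trans (cong (λ x → adj T x (σ c)) (sym glued)) (trans (adj-σ vs c) (S.adj-sym c~vs))

  not-regular : degree T′ vt ≢ 1
  not-regular regular =
    <⇒≱ (degree-two-isolated glue (σ c) (trans degree-glue-suc (cong suc regular)) glue~σc) σc-branch

  pendant-below : ∀ b {w} → Adj T (τ b) w → degree T w ≤ 1 →
                  ∃ λ b′ → τ b′ ≡ w × Adj T′ b b′ × degree T′ b′ ≤ 1
  pendant-below b {w} τb~w pendant with b Fin.≟ vt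
  ... | no b≢vt = let b′ , τb′≡w , b~b′ = neighbour-of-τ b≢vt τb~w in
    b′ , τb′≡w , b~b′ ,
    ≤-trans (degree-τ-≤ (tree-irreflexive tree-S) b′) (subst (λ x → degree T x ≤ 1) (sym τb′≡w) pendant)
  ... | yes refl with neighbour-of-glue τb~w
  ...   | inj₂ (b′ , refl , vt~b′) = b′ , refl , vt~b′ , ≤-trans (degree-τ-≤ (tree-irreflexive tree-S) b′) pendant
  ...   | inj₁ (a , refl , vs~a) with S.pendant-neighbour-unique (≤-reflexive vs-leaf) vs~a (S.adj-sym c~vs)
  ...     | refl = ⊥-elim (<⇒≱ (s≤s (≤-trans pendant (n≤1+n 1))) σc-branch)

  pendants-below : ∀ b → 3 ≤ degree T (τ b) → HasTwoPendants T′ b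
  pendants-below b branch with branch-pendants (τ b) branch
  ... | w₁ , w₂ , w₁≢w₂ , τb~w₁ , τb~w₂ , w₁-pendant , w₂-pendant
    with pendant-below b τb~w₁ w₁-pendant | pendant-below b τb~w₂ w₂-pendant
  ... | b₁ , refl , b~b₁ , b₁-pendant | b₂ , refl , b~b₂ , b₂-pendant =
    b₁ , b₂ , (w₁≢w₂ ∘ cong τ) , b~b₁ , b~b₂ , b₁-pendant , b₂-pendant

  neighbours-of-vt-pendant : degree T′ vt ≡ 2 → ∀ w → Adj T′ vt w → degree T′ w ≤ 1
  neighbours-of-vt-pendant deg-vt w =
    only-pendants tree-T′ (pendants-below vt (≤-reflexive (sym (trans degree-glue-suc (cong suc deg-vt))))) deg-vt

  -- Both neighbours of vt are pendant in T, so T′ is a path on three vertices.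
  T′-branchless : degree T′ vt ≡ 2 → ∀ u → degree T′ u < 3
  T′-branchless deg-vt u = near-vt (T′.confined (neighbours-of-vt-pendant deg-vt) (inj₁ refl) (tree-connected tree-T′ vt u))
    where
    near-vt : u ≡ vt ⊎ Adj T′ vt u → degree T′ u < 3
    near-vt (inj₁ refl) = s≤s (≤-reflexive deg-vt)
    near-vt (inj₂ vt~u) = s≤s (≤-trans (neighbours-of-vt-pendant deg-vt u vt~u) (n≤1+n 1))

  rigid-T′ : Rigid T′
  rigid-T′ = record
    { branch-pendants     = λ b branch → pendants-below b (≤-trans branch (degree-τ-≤ (tree-irreflexive tree-S) b))
    ; degree-two-isolated = isolated
    }
    where
    isolated : ∀ b b′ → degree T′ b ≡ 2 → Adj T′ b b′ → degree T′ b′ < 3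
    isolated b b′ deg-b b~b′ with b Fin.≟ vt
    ... | yes refl = T′-branchless deg-b b′
    ... | no b≢vt = ≤-<-trans (degree-τ-≤ (tree-irreflexive tree-S) b′)
                      (degree-two-isolated (τ b) (τ b′) (trans (degree-τ b b≢vt) deg-b) (adj-τ⁺ b~b′))

  branches-glued : 2 ≤ degree T′ vt → branches T + indicator (3 ≤ᵇ degree T′ vt) ≡ 2 + branches T′
  branches-glued irregular = begin
    branches T + indicator (3 ≤ᵇ degree T′ vt)
      ≡⟨ cong (_+ indicator (3 ≤ᵇ degree T′ vt)) (sym (+-identityʳ _)) ⟩
    branches T + 0 + indicator (3 ≤ᵇ degree T′ vt)
      ≡⟨ cong (λ d → branches T + indicator (3 ≤ᵇ d) + indicator (3 ≤ᵇ degree T′ vt)) (sym vs-leaf) ⟩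
    branches T + indicator (3 ≤ᵇ degree S vs) + indicator (3 ≤ᵇ degree T′ vt)
      ≡⟨ countVertices-glued (3 ≤ᵇ_) ⟩
    branches S + branches T′ + indicator (3 ≤ᵇ degree T glue)
      ≡⟨ cong₂ (λ x y → x + branches T′ + y) (branches-starlike c-centre) (cong indicator (is-branch glue-branch)) ⟩
    1 + branches T′ + 1
      ≡⟨ +-comm (1 + branches T′) 1 ⟩
    2 + branches T′ ∎
    where
    open ≡-Reasoning
    glue-branch : 3 ≤ degree T glue
    glue-branch = subst (3 ≤_) (sym degree-glue-suc) (s≤s irregular)

  ι-rigid-step : ∀ k → (Rigid T′ → k ≡ branches T′ ∸ 1) → irregularity T′ vt + k ≡ branches T ∸ 1
  ι-rigid-step k ih with degree T′ vt in deg-vt | branches-glued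
  ... | 0 | _ = ⊥-elim (<⇒≱ (s≤s z≤n) (subst (1 ≤_) deg-vt vt-not-isolated))
  ... | 1 | _ = ⊥-elim (not-regular deg-vt)
  ... | 2 | glued-count = begin
    1 + k                       ≡⟨ cong suc (trans (ih rigid-T′) (cong (_∸ 1) no-branches)) ⟩
    1                           ≡⟨ cong (_∸ 1) (sym (+-cancelʳ-≡ 0 (branches T) 2
                                      (trans (glued-count (s≤s (s≤s z≤n))) (cong (2 +_) no-branches)))) ⟩
    branches T ∸ 1              ∎
    where
    open ≡-Reasoning
    no-branches : branches T′ ≡ 0
    no-branches = branches-none (T′-branchless deg-vt)
  ... | suc (suc (suc d)) | glued-count = begin
    1 + k                       ≡⟨ cong suc (ih rigid-T′) ⟩
    1 + (branches T′ ∸ 1)       ≡⟨ m+[n∸m]≡n (branches-pos vt (subst (3 ≤_) (sym deg-vt) (s≤s (s≤s (s≤s z≤n))))) ⟩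
    branches T′                 ≡⟨ cong (_∸ 1) (sym (+-cancelʳ-≡ 1 (branches T) (1 + branches T′)
                                      (trans (glued-count (s≤s (s≤s z≤n))) (sym (+-comm (1 + branches T′) 1))))) ⟩
    branches T ∸ 1              ∎
    where open ≡-Reasoning

ι-rigid : ∀ {T k} → Rigid T → Iota T k → k ≡ branches T ∸ 1
ι-rigid _ (stop (inj₁ (_ , _ , centre))) = sym (cong (_∸ 1) (branches-starlike centre))
ι-rigid _ (stop (inj₂ (_ , path))) = sym (cong (_∸ 1) (branches-none (λ v → s≤s (degree-path-≤ path v))))
ι-rigid rigid (split {k = k} splitting decomposition) = ι-rigid-step k (λ rigid′ → ι-rigid rigid′ decomposition)
  where open RigidSplitting (fromSplitting splitting) rigid

attach : (G : Graph) → Fin (size G) → Graph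
attach G v = graph (suc (size G)) adjacency
  where
  adjacency : Fin (suc (size G)) → Fin (suc (size G)) → Bool
  adjacency fzero    fzero    = false
  adjacency fzero    (fsuc j) = does (j Fin.≟ v)
  adjacency (fsuc i) fzero    = does (i Fin.≟ v)
  adjacency (fsuc i) (fsuc j) = adj G i j

module _ {G : Graph} {v : Fin (size G)} where

  attach-~new : ∀ {w} → Adj (attach G v) w fzero → w ≡ fsuc v
  attach-~new {fsuc j} w~new = cong fsuc (does-true (j Fin.≟ v) w~new)

  attach-new~ : ∀ {w} → Adj (attach G v) fzero w → w ≡ fsuc v
  attach-new~ {fsuc j} new~w = cong fsuc (does-true (j Fin.≟ v) new~w)

  attach-symmetric : Symmetric G → Symmetric (attach G v)
  attach-symmetric symmetric fzero    fzero    = refl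
  attach-symmetric symmetric fzero    (fsuc j) = refl
  attach-symmetric symmetric (fsuc i) fzero    = refl
  attach-symmetric symmetric (fsuc i) (fsuc j) = symmetric i j

  attach-irreflexive : Irreflexive G → Irreflexive (attach G v)
  attach-irreflexive irreflexive fzero    = refl
  attach-irreflexive irreflexive (fsuc i) = irreflexive i

  attach-connected : Connected G → Connected (attach G v)
  attach-connected connected u w = to-v u ++ʷ from-v w
    where
    lift : ∀ {i j} → Walk G i j → Walk (attach G v) (fsuc i) (fsuc j)
    lift here       = here
    lift (step a w) = step a (lift w)
    to-v : ∀ u → Walk (attach G v) u (fsuc v)
    to-v fzero    = step (dec-true (v Fin.≟ v) refl) here
    to-v (fsuc i) = lift (connected i v)
    from-v : ∀ u → Walk (attach G v) (fsuc v) u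
    from-v fzero    = step (dec-true (v Fin.≟ v) refl) here
    from-v (fsuc i) = lift (connected v i)

  -- The new vertex has a single neighbour, so it lies on no cycle; a cycle avoiding it comes from G.
  attach-acyclic : Acyclic G → Acyclic (attach G v)
  attach-acyclic acyclic x xs long uniq linked with unmap fsuc (x ∷ xs) old
    where
    old : ∀ {y} → y ∈ x ∷ xs → ∃ λ i → fsuc i ≡ y
    old {fsuc i} _ = i , refl
    old {fzero} new∈ with cycle-neighbours x xs long uniq linked new∈
    ... | p , q , p≢q , p~new , new~q = ⊥-elim (p≢q (trans (attach-~new p~new) (sym (attach-new~ new~q))))
  ... | y ∷ ys , refl = acyclic y ys (subst (2 ≤_) (length-map fsuc ys) long) (Unique.map⁻ uniq)
      (Linked.map⁻ (subst (Linked (Adj (attach G v))) (cong (fsuc y ∷_) (sym (map-++ fsuc ys [ y ]))) linked))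

  attach-tree : IsTree G → IsTree (attach G v)
  attach-tree (_ , symmetric , irreflexive , connected , acyclic) =
    s≤s z≤n , attach-symmetric symmetric , attach-irreflexive irreflexive ,
    attach-connected connected , attach-acyclic acyclic

star : ℕ → Graph
star m = graph (suc m) adjacency
  where
  adjacency : Fin (suc m) → Fin (suc m) → Bool
  adjacency fzero    (fsuc _) = true
  adjacency (fsuc _) fzero    = true
  adjacency _        _        = false

module _ {m : ℕ} where

  star-leaf~ : ∀ {i w} → Adj (star m) (fsuc i) w → w ≡ fzero
  star-leaf~ {w = fzero} _ = refl

  star-tree : IsTree (star m)
  star-tree = s≤s z≤n , symmetric , irreflexive , connected , acyclic
    where
    symmetric : Symmetric (star m)
    symmetric fzero    fzero    = refl
    symmetric fzero    (fsuc _) = refl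
    symmetric (fsuc _) fzero    = refl
    symmetric (fsuc _) (fsuc _) = refl

    irreflexive : Irreflexive (star m)
    irreflexive fzero    = refl
    irreflexive (fsuc _) = refl

    to-centre : ∀ u → Walk (star m) u fzero
    to-centre fzero    = here
    to-centre (fsuc _) = step refl here

    from-centre : ∀ u → Walk (star m) fzero u
    from-centre fzero    = here
    from-centre (fsuc _) = step refl here

    connected : Connected (star m)
    connected u w = to-centre u ++ʷ from-centre w

    acyclic : Acyclic (star m)
    acyclic x (x₁ ∷ xs) long uniq@((x≢x₁ ∷ _) ∷ _) linked =
      x≢x₁ (trans (centre-on-cycle (here refl)) (sym (centre-on-cycle (there (here refl)))))
      where
      centre-on-cycle : ∀ {y} → y ∈ x ∷ x₁ ∷ xs → y ≡ fzero
      centre-on-cycle {fzero}  _  = refl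
      centre-on-cycle {fsuc i} y∈ with cycle-neighbours x (x₁ ∷ xs) long uniq linked y∈
      ... | p , q , p≢q , p~y , y~q =
        ⊥-elim (p≢q (trans (star-leaf~ (trans (symmetric (fsuc i) p) p~y)) (sym (star-leaf~ y~q))))

degree-star-centre : ∀ m → degree (star m) fzero ≡ m
degree-star-centre m = trans (sumFin-suc m (indicator ∘ adj (star m) fzero)) (countFin-true m)

degree-star-leaf : ∀ m i → degree (star m) (fsuc i) ≡ 1
degree-star-leaf m i = trans (sumFin-suc m (indicator ∘ adj (star m) (fsuc i))) (cong suc (sumFin-zero m (λ _ → refl)))

leaves-star : ∀ m → leaves (star (suc (suc m))) ≡ suc (suc m)
leaves-star m = begin
  leaves (star (suc (suc m)))
    ≡⟨ sumFin-suc (suc (suc m)) (λ v → indicator (degree (star (suc (suc m))) v ≡ᵇ 1)) ⟩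
  indicator (degree (star (suc (suc m))) fzero ≡ᵇ 1) + countFin (suc (suc m)) (λ i → degree (star (suc (suc m))) (fsuc i) ≡ᵇ 1)
    ≡⟨ cong₂ (λ d c → indicator (d ≡ᵇ 1) + c) (degree-star-centre (suc (suc m)))
         (sumFin-cong (suc (suc m)) (λ i → cong (λ d → indicator (d ≡ᵇ 1)) (degree-star-leaf _ i))) ⟩
  countFin (suc (suc m)) (λ _ → true)
    ≡⟨ countFin-true (suc (suc m)) ⟩
  suc (suc m) ∎
  where open ≡-Reasoning

star-centre : ∀ {m} → 3 ≤ m → IsCentre (star m) fzero
star-centre {m} m≥3 = subst (3 ≤_) (sym (degree-star-centre m)) m≥3 , only-centre
  where
  only-centre : ∀ v → 3 ≤ degree (star m) v → v ≡ fzero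
  only-centre fzero    _      = refl
  only-centre (fsuc i) branch with subst (3 ≤_) (degree-star-leaf m i) branch
  ... | s≤s ()

star-2-path : IsPath (star 2)
star-2-path = 3 , mk↔ₛ′ swap swap involutive involutive , adjacency
  where
  swap : Fin 3 → Fin 3
  swap fzero               = fsuc fzero
  swap (fsuc fzero)        = fzero
  swap (fsuc (fsuc fzero)) = fsuc (fsuc fzero)
  involutive : ∀ i → swap (swap i) ≡ i
  involutive fzero               = refl
  involutive (fsuc fzero)        = refl
  involutive (fsuc (fsuc fzero)) = refl
  adjacency : ∀ i j → adj (pathGraph 3) (swap i) (swap j) ≡ adj (star 2) i j
  adjacency fzero               fzero               = refl
  adjacency fzero               (fsuc fzero)        = refl
  adjacency fzero               (fsuc (fsuc fzero)) = refl
  adjacency (fsuc fzero)        fzero               = refl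
  adjacency (fsuc fzero)        (fsuc fzero)        = refl
  adjacency (fsuc fzero)        (fsuc (fsuc fzero)) = refl
  adjacency (fsuc (fsuc fzero)) fzero               = refl
  adjacency (fsuc (fsuc fzero)) (fsuc fzero)        = refl
  adjacency (fsuc (fsuc fzero)) (fsuc (fsuc fzero)) = refl

cherry : (T : Graph) → Fin (size T) → Graph
cherry T r = attach (attach (attach T r) fzero) (fsuc fzero)

-- Vertices of cherry T r: 0 and 1 are the new leaves, 2 is the new centre and 3 + q is the vertex q of T.
module Cherry (T : Graph) (r : Fin (size T)) (irreflexive : Irreflexive T) where

  E : Graph
  E = cherry T r

  centre : Fin (size E)
  centre = fsuc (fsuc fzero)

  old : Fin (size T) → Fin (size E)
  old q = fsuc (fsuc (fsuc q))

  σ : Fin 4 → Fin (size E)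
  σ fzero                      = centre
  σ (fsuc fzero)               = old r
  σ (fsuc (fsuc fzero))        = fsuc fzero
  σ (fsuc (fsuc (fsuc fzero))) = fzero

  σ⁻¹ : Fin (size E) → Fin 4
  σ⁻¹ fzero               = fsuc (fsuc (fsuc fzero))
  σ⁻¹ (fsuc fzero)        = fsuc (fsuc fzero)
  σ⁻¹ (fsuc (fsuc fzero)) = fzero
  σ⁻¹ (fsuc (fsuc (fsuc _))) = fsuc fzero

  σ⁻¹-σ : ∀ a → σ⁻¹ (σ a) ≡ a
  σ⁻¹-σ fzero                      = refl
  σ⁻¹-σ (fsuc fzero)               = refl
  σ⁻¹-σ (fsuc (fsuc fzero))        = refl
  σ⁻¹-σ (fsuc (fsuc (fsuc fzero))) = refl

  σ-injective : ∀ {a b} → σ a ≡ σ b → a ≡ b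
  σ-injective {a} {b} σa≡σb = trans (sym (σ⁻¹-σ a)) (trans (cong σ⁻¹ σa≡σb) (σ⁻¹-σ b))

  old-injective : ∀ {p q} → old p ≡ old q → p ≡ q
  old-injective refl = refl

  centre~old-root : Adj E centre (old r)
  centre~old-root = dec-true (r Fin.≟ r) refl

  cherry-glue : Glue E (star 3) T (fsuc fzero) r
  cherry-glue = σ , old , σ-injective , old-injective , refl , meet , cover , adj-σ , (λ _ _ → refl) , adj-cross
    where
    meet : ∀ a q → σ a ≡ old q → a ≡ fsuc fzero × q ≡ r
    meet a q σa≡old with trans (sym (σ⁻¹-σ a)) (cong σ⁻¹ σa≡old)
    ... | refl = refl , old-injective (sym σa≡old)
    cover : ∀ x → (∃ λ a → σ a ≡ x) ⊎ (∃ λ q → old q ≡ x)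
    cover fzero                   = inj₁ (fsuc (fsuc (fsuc fzero)) , refl)
    cover (fsuc fzero)            = inj₁ (fsuc (fsuc fzero) , refl)
    cover (fsuc (fsuc fzero))     = inj₁ (fzero , refl)
    cover (fsuc (fsuc (fsuc q)))  = inj₂ (q , refl)
    adj-σ : ∀ a b → adj E (σ a) (σ b) ≡ adj (star 3) a b
    adj-σ fzero                    fzero                    = refl
    adj-σ fzero                    (fsuc fzero)             = centre~old-root
    adj-σ fzero                    (fsuc (fsuc fzero))      = refl
    adj-σ fzero                    (fsuc (fsuc (fsuc fzero))) = refl
    adj-σ (fsuc fzero)             fzero                    = centre~old-root
    adj-σ (fsuc fzero)             (fsuc fzero)             = irreflexive r
    adj-σ (fsuc fzero)             (fsuc (fsuc fzero))      = refl
    adj-σ (fsuc fzero)             (fsuc (fsuc (fsuc fzero))) = refl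
    adj-σ (fsuc (fsuc fzero))      fzero                    = refl
    adj-σ (fsuc (fsuc fzero))      (fsuc fzero)             = refl
    adj-σ (fsuc (fsuc fzero))      (fsuc (fsuc fzero))      = refl
    adj-σ (fsuc (fsuc fzero))      (fsuc (fsuc (fsuc fzero))) = refl
    adj-σ (fsuc (fsuc (fsuc fzero))) fzero                  = refl
    adj-σ (fsuc (fsuc (fsuc fzero))) (fsuc fzero)           = refl
    adj-σ (fsuc (fsuc (fsuc fzero))) (fsuc (fsuc fzero))    = refl
    adj-σ (fsuc (fsuc (fsuc fzero))) (fsuc (fsuc (fsuc fzero))) = refl
    adj-cross : ∀ a q → a ≢ fsuc fzero → q ≢ r → adj E (σ a) (old q) ≡ false × adj E (old q) (σ a) ≡ false
    adj-cross fzero                      q _ q≢r = dec-false (q Fin.≟ r) q≢r , dec-false (q Fin.≟ r) q≢r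
    adj-cross (fsuc fzero)               q a≢vs _ = ⊥-elim (a≢vs refl)
    adj-cross (fsuc (fsuc fzero))        q _ _ = refl , refl
    adj-cross (fsuc (fsuc (fsuc fzero))) q _ _ = refl , refl

record Caterpillar (G : Graph) (r : Fin (size G)) (a ℓ : ℕ) : Set where
  field
    tree            : IsTree G
    root-pendants   : HasTwoPendants G r
    branch-pendants : ∀ v → 3 ≤ degree G v → HasTwoPendants G v
    degree-two-root : ∀ v → degree G v ≡ 2 → v ≡ r
    leaf-count      : leaves G ≡ ℓ
    decomposition   : Iota G a

  root-degree : 2 ≤ degree G r
  root-degree = two-pendants-degree tree root-pendants

  rigid : Rigid G
  rigid = record { branch-pendants = branch-pendants ; degree-two-isolated = isolated }
    where
    isolated : ∀ v w → degree G v ≡ 2 → Adj G v w → degree G w < 3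
    isolated v w deg-v v~w with degree-two-root v deg-v
    ... | refl = s≤s (≤-trans (only-pendants tree root-pendants deg-v v~w) (n≤1+n 1))

caterpillar-star : ∀ m → Caterpillar (star (suc (suc m))) fzero 0 (suc (suc m))
caterpillar-star m = record
  { tree            = star-tree
  ; root-pendants   = pendants
  ; branch-pendants = branch-pendants
  ; degree-two-root = degree-two-root
  ; leaf-count      = leaves-star m
  ; decomposition   = stop (starlike-or-path m)
  }
  where
  pendants : HasTwoPendants (star (suc (suc m))) fzero
  pendants = fsuc fzero , fsuc (fsuc fzero) , (λ ()) , refl , refl ,
             ≤-reflexive (degree-star-leaf (suc (suc m)) fzero) , ≤-reflexive (degree-star-leaf (suc (suc m)) (fsuc fzero))
  branch-pendants : ∀ v → 3 ≤ degree (star (suc (suc m))) v → HasTwoPendants (star (suc (suc m))) v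
  branch-pendants fzero    _      = pendants
  branch-pendants (fsuc i) branch with subst (3 ≤_) (degree-star-leaf (suc (suc m)) i) branch
  ... | s≤s ()
  degree-two-root : ∀ v → degree (star (suc (suc m))) v ≡ 2 → v ≡ fzero
  degree-two-root fzero    _     = refl
  degree-two-root (fsuc i) deg-i with trans (sym (degree-star-leaf (suc (suc m)) i)) deg-i
  ... | ()
  starlike-or-path : ∀ m → Starlike (star (suc (suc m))) ⊎ (IsTree (star (suc (suc m))) × IsPath (star (suc (suc m))))
  starlike-or-path zero    = inj₂ (star-tree , star-2-path)
  starlike-or-path (suc m) = inj₁ (star-tree , fzero , star-centre (s≤s (s≤s (s≤s z≤n))))

module CherryOnCaterpillar {T r a ℓ} (cat : Caterpillar T r a ℓ) where

  open Caterpillar cat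
  open Cherry T r (tree-irreflexive tree)
  open GluingLemmas (fromGlue {E} {star 3} {T} cherry-glue) using (degree-σ; degree-τ; degree-glue; countVertices-glued)

  root-or-not : ∀ q → q ≡ r ⊎ q ≢ r
  root-or-not q with q Fin.≟ r
  ... | yes q≡r = inj₁ q≡r
  ... | no  q≢r = inj₂ q≢r

  degree-centre : degree E centre ≡ 3
  degree-centre = trans (degree-σ fzero (λ ())) (degree-star-centre 3)

  degree-new-leaf₁ : degree E (fsuc fzero) ≡ 1
  degree-new-leaf₁ = trans (degree-σ (fsuc (fsuc fzero)) (λ ())) (degree-star-leaf 3 (fsuc fzero))

  degree-new-leaf₂ : degree E fzero ≡ 1
  degree-new-leaf₂ = trans (degree-σ (fsuc (fsuc (fsuc fzero))) (λ ())) (degree-star-leaf 3 (fsuc (fsuc fzero)))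

  degree-old-root : degree E (old r) ≡ suc (degree T r)
  degree-old-root = trans (degree-glue (tree-irreflexive star-tree)) (cong (_+ degree T r) (degree-star-leaf 3 fzero))

  old-root-branch : 3 ≤ degree E (old r)
  old-root-branch = subst (3 ≤_) (sym degree-old-root) (s≤s root-degree)

  splitting : Splitting E (star 3) T (fsuc fzero) r
  splitting = (centre , old r , (λ ()) , ≤-reflexive (sym degree-centre) , old-root-branch) ,
              (star-tree , fzero , star-centre ≤-refl) , tree ,
              (fzero , star-centre ≤-refl , degree-star-leaf 3 fzero , refl) , cherry-glue

  cherry-leaf-count : leaves E ≡ 2 + ℓ
  cherry-leaf-count = +-cancelʳ-≡ 1 (leaves E) (2 + ℓ) (begin
    leaves E + 1
      ≡⟨ sym (+-identityʳ _) ⟩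
    leaves E + 1 + 0
      ≡⟨ cong₂ (λ d b → leaves E + indicator (d ≡ᵇ 1) + indicator b)
           (sym (degree-star-leaf 3 fzero)) (sym (not-leaf root-degree)) ⟩
    leaves E + indicator (degree (star 3) (fsuc fzero) ≡ᵇ 1) + indicator (degree T r ≡ᵇ 1)
      ≡⟨ countVertices-glued (_≡ᵇ 1) ⟩
    leaves (star 3) + leaves T + indicator (degree E (old r) ≡ᵇ 1)
      ≡⟨ cong₂ (λ l b → l + leaves T + indicator b) (leaves-star 1) (not-leaf (≤-trans (n≤1+n 2) old-root-branch)) ⟩
    3 + leaves T + 0
      ≡⟨ trans (+-identityʳ _) (cong (3 +_) leaf-count) ⟩
    3 + ℓ
      ≡⟨ +-comm 1 (2 + ℓ) ⟩
    2 + ℓ + 1 ∎)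
    where open ≡-Reasoning

  centre-pendants : HasTwoPendants E centre
  centre-pendants = fsuc fzero , fzero , (λ ()) , refl , refl , ≤-reflexive degree-new-leaf₁ , ≤-reflexive degree-new-leaf₂

  pendant-lift : ∀ {w} → degree T w ≤ 1 → degree E (old w) ≤ 1
  pendant-lift {w} pendant with root-or-not w
  ... | inj₁ refl = ⊥-elim (<⇒≱ (s≤s pendant) root-degree)
  ... | inj₂ w≢r = subst (_≤ 1) (sym (degree-τ w w≢r)) pendant

  pendants-lift : ∀ {q} → HasTwoPendants T q → HasTwoPendants E (old q)
  pendants-lift (w₁ , w₂ , w₁≢w₂ , q~w₁ , q~w₂ , w₁-pendant , w₂-pendant) =
    old w₁ , old w₂ , w₁≢w₂ ∘ old-injective , q~w₁ , q~w₂ , pendant-lift w₁-pendant , pendant-lift w₂-pendant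

  cherry-branch-pendants : ∀ v → 3 ≤ degree E v → HasTwoPendants E v
  cherry-branch-pendants fzero branch with subst (3 ≤_) degree-new-leaf₂ branch
  ... | s≤s ()
  cherry-branch-pendants (fsuc fzero) branch with subst (3 ≤_) degree-new-leaf₁ branch
  ... | s≤s ()
  cherry-branch-pendants (fsuc (fsuc fzero)) _ = centre-pendants
  cherry-branch-pendants (fsuc (fsuc (fsuc q))) branch with root-or-not q
  ... | inj₁ refl = pendants-lift root-pendants
  ... | inj₂ q≢r = pendants-lift (branch-pendants q (subst (3 ≤_) (degree-τ q q≢r) branch))

  cherry-degree-two-root : ∀ v → degree E v ≡ 2 → v ≡ centre
  cherry-degree-two-root fzero deg-v with trans (sym degree-new-leaf₂) deg-v
  ... | ()
  cherry-degree-two-root (fsuc fzero) deg-v with trans (sym degree-new-leaf₁) deg-v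
  ... | ()
  cherry-degree-two-root (fsuc (fsuc fzero)) _ = refl
  cherry-degree-two-root (fsuc (fsuc (fsuc q))) deg-v with root-or-not q
  ... | inj₁ refl = ⊥-elim (<⇒≱ (s≤s (≤-reflexive deg-v)) old-root-branch)
  ... | inj₂ q≢r = ⊥-elim (q≢r (degree-two-root q (trans (sym (degree-τ q q≢r)) deg-v)))

  caterpillar-cherry : Caterpillar E centre (suc a) (2 + ℓ)
  caterpillar-cherry = record
    { tree            = attach-tree (attach-tree (attach-tree tree))
    ; root-pendants   = centre-pendants
    ; branch-pendants = cherry-branch-pendants
    ; degree-two-root = cherry-degree-two-root
    ; leaf-count      = cherry-leaf-count
    ; decomposition   = subst (Iota E) (cong (λ b → (if b then 0 else 1) + a) (not-leaf root-degree))
                          (split splitting decomposition)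
    }

caterpillar : ∀ a m → Σ Graph λ G → Σ (Fin (size G)) λ r → Caterpillar G r a (2 * a + suc (suc m))
caterpillar zero    m = star (suc (suc m)) , fzero , caterpillar-star m
caterpillar (suc a) m with caterpillar a m
... | G , r , cat = cherry G r , fsuc (fsuc fzero) ,
                    subst (Caterpillar (cherry G r) _ (suc a)) leaves-eq (CherryOnCaterpillar.caterpillar-cherry cat)
  where
  leaves-eq : 2 + (2 * a + suc (suc m)) ≡ 2 * suc a + suc (suc m)
  leaves-eq = trans (sym (+-assoc 2 (2 * a) _)) (cong (_+ suc (suc m)) (sym (*-suc 2 a)))

tree-with-ι-and-leaves : (a b : ℕ) → 2 * a + 2 ≤ b →
  Σ Graph (λ T → IsTree T × leaves T ≡ b × Iota T a × ((k : ℕ) → Iota T k → k ≡ a))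
tree-with-ι-and-leaves a b bound with caterpillar a (b ∸ (2 * a + 2))
... | G , r , cat = G , tree , trans leaf-count leaves-eq , decomposition ,
      λ k other → trans (ι-rigid rigid other) (sym (ι-rigid rigid decomposition))
  where
  open Caterpillar cat
  leaves-eq : 2 * a + suc (suc (b ∸ (2 * a + 2))) ≡ b
  leaves-eq = trans (sym (+-assoc (2 * a) 2 _)) (m+[n∸m]≡n bound)

proposition5p2 : ((T : Graph) → IsTree T → 2 ≤ size T → (k : ℕ) → Iota T k → 2 * k + 2 ≤ leaves T)
    × ((a b : ℕ) → 2 * a + 2 ≤ b →
        Σ Graph (λ T → IsTree T × leaves T ≡ b × Iota T a × ((k : ℕ) → Iota T k → k ≡ a)))
    × ((T : Graph) → IsTree T → (k : ℕ) → Iota T k →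
        (0 < k → AdjacentBranches T) × (AdjacentBranches T → 0 < k))
proposition5p2 =
  leaves-lower-bound ,
  tree-with-ι-and-leaves ,
  λ T _ k decomposition → adjacent-branches-if-irregular T k decomposition ,
                          irregular-if-adjacent-branches T k decomposition
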